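{- For every integer $t\ge 1$, $$\liminf_{n\to\infty}\frac{orsat(n,K_{t+2})}{n^{3/2}}=\frac{\sqrt{t}}{2}.$$
   Context: All graphs are finite and simple. For a graph $F$, a graph $G$ is $F$-oversaturated if for every pair $e$ of non-adjacent vertices of $G$, the graph obtained from $G$ by adding the edge $e$ contains a copy of $F$ that uses the edge $e$ ($G$ itself is not required to be $F$-free). $orsat(n,F)$ denotes the smallest number of edges in a regular $n$-vertex $F$-oversaturated graph. $K_{t+2}$ is the complete graph on $t+2$ vertices. -}

module Defs where

open import Data.Nat using (ℕ; zero; suc; _+_; _*_; _^_; _<_; _≤_; _<ᵇ_)
open import Data.Fin using (Fin; toℕ; _≟_)
import Data.Fin as F
open import Data.Bool using (Bool; true; false; if_then_else_; _∧_; _∨_)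
open import Data.Product using (Σ; ∃; ∃-syntax; _×_; _,_)
open import Relation.Binary.PropositionalEquality using (_≡_; _≢_)
open import Relation.Nullary.Decidable using (⌊_⌋)

record Graph (n : ℕ) : Set where
  field
    adj    : Fin n → Fin n → Bool
    sym    : ∀ i j → adj i j ≡ adj j i
    irrefl : ∀ i → adj i i ≡ false
open Graph public

count : ∀ {n} → (Fin n → Bool) → ℕ
count {zero}  p = 0
count {suc n} p = (if p F.zero then 1 else 0) + count (λ x → p (F.suc x))

sumFin : ∀ {n} → (Fin n → ℕ) → ℕ
sumFin {zero}  f = 0
sumFin {suc n} f = f F.zero + sumFin (λ x → f (F.suc x))

degree : ∀ {n} → Graph n → Fin n → ℕ
degree G i = count (adj G i)

edges : ∀ {n} → Graph n → ℕ
edges G = sumFin (λ i → count (λ j → (toℕ i <ᵇ toℕ j) ∧ adj G i j))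

Regular : ∀ {n} → Graph n → Set
Regular {n} G = ∃[ d ] (∀ (i : Fin n) → degree G i ≡ d)

addEdge : ∀ {n} → (Fin n → Fin n → Bool) → Fin n → Fin n → Fin n → Fin n → Bool
addEdge a u v x y =
  a x y ∨ ((⌊ x ≟ u ⌋ ∧ ⌊ y ≟ v ⌋) ∨ (⌊ x ≟ v ⌋ ∧ ⌊ y ≟ u ⌋))

-- a copy of K_k in the graph with adjacency a whose vertex set contains u and v
-- (so, when uv is the added edge, the copy uses the edge uv)
CliqueThrough : ∀ {n} → (Fin n → Fin n → Bool) → ℕ → Fin n → Fin n → Set
CliqueThrough {n} a k u v =
  Σ (Fin k → Fin n) λ f →
    (∀ i j → f i ≡ f j → i ≡ j) ×
    (∀ i j → i ≢ j → a (f i) (f j) ≡ true) ×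
    (∃[ i ] f i ≡ u) × (∃[ j ] f j ≡ v)

KOversaturated : ∀ {n} → ℕ → Graph n → Set
KOversaturated {n} t G =
  ∀ (u v : Fin n) → u ≢ v → adj G u v ≡ false →
    CliqueThrough (addEdge (adj G) u v) (t + 2) u v

IsOrsat : ℕ → ℕ → ℕ → Set
IsOrsat t n m =
  (Σ (Graph n) λ G → Regular G × KOversaturated t G × edges G ≡ m) ×
  (∀ (G : Graph n) → Regular G → KOversaturated t G → m ≤ edges G)

-- Lower bound: in a d-regular K_{t+2}-oversaturated graph on n vertices, joining two non-adjacent
-- vertices creates a K_{t+2}, whose other t vertices are common neighbours of the pair. Counting the
-- paths of length two from a vertex therefore gives t (n - 1 - d) ≤ d², so d ≥ (1 - o(1)) √(t n)
-- and the graph has n d / 2 ≥ (√t / 2 - o(1)) n^{3/2} edges.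
--
-- Upper bound: take the Erdős–Rényi polarity graph of the projective plane over 𝔽ₚ, made
-- (p + 1)-regular by pairing up its p + 1 absolute points, and blow every vertex up into a clique
-- of size t, joining the cliques of adjacent vertices completely. Two non-adjacent points have a
-- common neighbour in the polarity graph (the pole of the line through them), so two non-adjacent
-- vertices of the blow-up together with the clique of such a neighbour form a K_{t+2}. The blow-up
-- is (t (p + 2) - 1)-regular on n = t (p² + p + 1) vertices, hence has (√t / 2 + o(1)) n^{3/2}
-- edges, and p can be any odd prime.

module Submission where

open import Data.Nat using (ℕ; _<_)
open import Data.Nat.Primality using (Prime)

module Counting where

  open import Defs using (count; sumFin)
  open import Data.Bool using (Bool; true; false; if_then_else_; _∧_; _∨_; not)
  open import Data.Empty using (⊥-elim)
  open import Data.Fin using (Fin; zero; suc; _≟_; _↑ˡ_; _↑ʳ_; combine)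
  open import Data.Fin.Properties using (pigeonhole; suc-injective; <⇒≢)
  open import Data.Nat using (ℕ; zero; suc; _+_; _*_; _≤_; z≤n)
  import Data.Nat.Properties as ℕ
  open import Data.Nat.Properties
    using (+-commutativeSemigroup; +-assoc; +-identityʳ; *-zeroʳ; *-identityʳ; *-distribˡ-+; +-mono-≤; _≤?_; ≰⇒>)
  open import Algebra.Properties.CommutativeSemigroup +-commutativeSemigroup using (interchange)
  open import Data.Product using (_,_)
  open import Function using (_∘_; id)
  open import Relation.Nullary using (Dec; does; yes; no)
  open import Relation.Nullary.Decidable using (dec-true)
  open import Relation.Binary.PropositionalEquality

  does-sound : ∀ {a} {A : Set a} (a? : Dec A) → does a? ≡ true → A
  does-sound (yes a) _  = a
  does-sound (no _)  ()

  indicator : Bool → ℕ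
  indicator b = if b then 1 else 0

  count≡sum-indicator : ∀ {n} (P : Fin n → Bool) → count P ≡ sumFin (indicator ∘ P)
  count≡sum-indicator {zero}  P = refl
  count≡sum-indicator {suc n} P = cong (indicator (P zero) +_) (count≡sum-indicator (P ∘ suc))

  sumFin-cong : ∀ {n} {f g : Fin n → ℕ} → (∀ x → f x ≡ g x) → sumFin f ≡ sumFin g
  sumFin-cong {zero}  f≗g = refl
  sumFin-cong {suc n} f≗g = cong₂ _+_ (f≗g zero) (sumFin-cong (f≗g ∘ suc))

  count-cong : ∀ {n} {P Q : Fin n → Bool} → (∀ x → P x ≡ Q x) → count P ≡ count Q
  count-cong {zero}  P≗Q = refl
  count-cong {suc n} P≗Q = cong₂ _+_ (cong indicator (P≗Q zero)) (count-cong (P≗Q ∘ suc))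

  sumFin-+ : ∀ {n} (f g : Fin n → ℕ) → sumFin (λ x → f x + g x) ≡ sumFin f + sumFin g
  sumFin-+ {zero}  f g = refl
  sumFin-+ {suc n} f g = trans (cong (f zero + g zero +_) (sumFin-+ (f ∘ suc) (g ∘ suc)))
                               (interchange (f zero) (g zero) _ _)

  sumFin-const : ∀ n c → sumFin {n} (λ _ → c) ≡ n * c
  sumFin-const zero    c = refl
  sumFin-const (suc n) c = cong (c +_) (sumFin-const n c)

  sumFin-comm : ∀ {m n} (f : Fin m → Fin n → ℕ) →
    sumFin (λ i → sumFin (f i)) ≡ sumFin (λ j → sumFin (λ i → f i j))
  sumFin-comm {zero}  {n} f = sym (trans (sumFin-const n 0) (*-zeroʳ n))
  sumFin-comm {suc m} f = trans (cong (sumFin (f zero) +_) (sumFin-comm (f ∘ suc)))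
                                (sym (sumFin-+ (f zero) (λ j → sumFin (λ i → f (suc i) j))))

  sumFin-mono-≤ : ∀ {n} {f g : Fin n → ℕ} → (∀ x → f x ≤ g x) → sumFin f ≤ sumFin g
  sumFin-mono-≤ {zero}  f≤g = z≤n
  sumFin-mono-≤ {suc n} f≤g = +-mono-≤ (f≤g zero) (sumFin-mono-≤ (f≤g ∘ suc))

  sumFin-*ˡ : ∀ {n} c (f : Fin n → ℕ) → sumFin (λ x → c * f x) ≡ c * sumFin f
  sumFin-*ˡ {zero}  c f = sym (*-zeroʳ c)
  sumFin-*ˡ {suc n} c f = trans (cong (c * f zero +_) (sumFin-*ˡ c (f ∘ suc)))
                                (sym (*-distribˡ-+ c (f zero) _))

  count-const : ∀ n b → count {n} (λ _ → b) ≡ n * indicator b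
  count-const zero    b = refl
  count-const (suc n) b = cong (indicator b +_) (count-const n b)

  count-true : ∀ n → count {n} (λ _ → true) ≡ n
  count-true n = trans (count-const n true) (*-identityʳ n)

  count-false : ∀ n → count {n} (λ _ → false) ≡ 0
  count-false n = trans (count-const n false) (*-zeroʳ n)

  count-∧-indicator : ∀ {n} b (P : Fin n → Bool) → count (λ x → b ∧ P x) ≡ indicator b * count P
  count-∧-indicator {n} false P = count-false n
  count-∧-indicator     true  P = sym (+-identityʳ (count P))

  count-split : ∀ {n} (P Q : Fin n → Bool) →
    count P ≡ count (λ x → P x ∧ Q x) + count (λ x → P x ∧ not (Q x))
  count-split {n} P Q = begin
    count P                                                         ≡⟨ count≡sum-indicator P ⟩
    sumFin (indicator ∘ P)                                          ≡⟨ sumFin-cong (λ x → split (P x) (Q x)) ⟩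
    sumFin (λ x → indicator (P x ∧ Q x) + indicator (P x ∧ not (Q x))) ≡⟨ sumFin-+ {n} _ _ ⟩
    sumFin (λ x → indicator (P x ∧ Q x)) + sumFin (λ x → indicator (P x ∧ not (Q x)))
      ≡⟨ sym (cong₂ _+_ (count≡sum-indicator {n} _) (count≡sum-indicator {n} _)) ⟩
    count (λ x → P x ∧ Q x) + count (λ x → P x ∧ not (Q x))         ∎
    where
    open ≡-Reasoning
    split : ∀ a b → indicator a ≡ indicator (a ∧ b) + indicator (a ∧ not b)
    split false b     = refl
    split true  false = refl
    split true  true  = refl

  count-∨-disjoint : ∀ {n} (P Q : Fin n → Bool) → (∀ x → P x ∧ Q x ≡ false) →
    count (λ x → P x ∨ Q x) ≡ count P + count Q
  count-∨-disjoint {n} P Q disjoint = begin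
    count (λ x → P x ∨ Q x)                           ≡⟨ count≡sum-indicator {n} _ ⟩
    sumFin (λ x → indicator (P x ∨ Q x))              ≡⟨ sumFin-cong (λ x → split (P x) (Q x) (disjoint x)) ⟩
    sumFin (λ x → indicator (P x) + indicator (Q x))  ≡⟨ sumFin-+ {n} _ _ ⟩
    sumFin (indicator ∘ P) + sumFin (indicator ∘ Q)   ≡⟨ cong₂ _+_ (count≡sum-indicator P) (count≡sum-indicator Q) ⟨
    count P + count Q                                 ∎
    where
    open ≡-Reasoning
    split : ∀ a b → a ∧ b ≡ false → indicator (a ∨ b) ≡ indicator a + indicator b
    split false b    _ = refl
    split true false _ = refl

  count-↑ : ∀ m {k} (P : Fin (m + k) → Bool) →
    count P ≡ count {m} (λ i → P (i ↑ˡ k)) + count {k} (λ j → P (m ↑ʳ j))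
  count-↑ zero    P = refl
  count-↑ (suc m) P = trans (cong (indicator (P zero) +_) (count-↑ m (P ∘ suc)))
                            (sym (+-assoc (indicator (P zero)) _ _))

  count-combine : ∀ m {k} (P : Fin (m * k) → Bool) →
    count P ≡ sumFin {m} (λ i → count {k} (λ j → P (combine i j)))
  count-combine zero    P = refl
  count-combine (suc m) {k} P =
    trans (count-↑ k P) (cong (count (λ j → P (j ↑ˡ (m * k))) +_) (count-combine m (λ x → P (k ↑ʳ x))))

  count-unique : ∀ {n} (P : Fin n → Bool) (u : Fin n) → P u ≡ true →
    (∀ x → P x ≡ true → x ≡ u) → count P ≡ 1
  count-unique {suc n} P zero Pu unique = cong₂ _+_ (cong indicator Pu) (trans (count-cong nowhere-else) (count-false n))
    where
    nowhere-else : ∀ x → P (suc x) ≡ false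
    nowhere-else x with P (suc x) in Psx
    ... | true with () ← unique (suc x) Psx
    ... | false = refl
  count-unique P (suc u) Pu unique with P zero in P0
  ... | true with () ← unique zero P0
  ... | false = count-unique (P ∘ suc) u Pu (λ x Px → suc-injective (unique (suc x) Px))

  count-≟ : ∀ {n} (u : Fin n) → count (λ x → does (x ≟ u)) ≡ 1
  count-≟ u = count-unique _ u (dec-true (u ≟ u) refl) (λ x → does-sound (x ≟ u))

  count-≢ : ∀ {n} (a : Fin (suc n)) → count (λ s → not (does (s ≟ a))) ≡ n
  count-≢ {n} a = ℕ.suc-injective (sym (begin
    suc n                            ≡⟨ count-true (suc n) ⟨
    count {suc n} (λ _ → true)       ≡⟨ count-split (λ _ → true) (λ s → does (s ≟ a)) ⟩
    count (λ s → does (s ≟ a)) + m   ≡⟨ cong (_+ m) (count-≟ a) ⟩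
    suc m                            ∎))
    where
    open ≡-Reasoning
    m = count (λ s → not (does (s ≟ a)))

  private
    here : ∀ b {c} → b ≡ true → Fin (indicator b + c)
    here true _ = zero

    there : ∀ b {c} → Fin c → Fin (indicator b + c)
    there true  y = suc y
    there false y = y

    here≢there : ∀ b {c} (b≡true : b ≡ true) (y : Fin c) → here b b≡true ≢ there b y
    here≢there true _ _ ()

    there-injective : ∀ b {c} {x y : Fin c} → there b x ≡ there b y → x ≡ y
    there-injective true  = suc-injective
    there-injective false = id

  rank : ∀ {n} (P : Fin n → Bool) x → P x ≡ true → Fin (count P)
  rank P zero    Px = here (P zero) Px
  rank P (suc x) Px = there (P zero) (rank (P ∘ suc) x Px)

  rank-injective : ∀ {n} (P : Fin n → Bool) x y (Px : P x ≡ true) (Py : P y ≡ true) →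
    rank P x Px ≡ rank P y Py → x ≡ y
  rank-injective P zero    zero    Px Py same = refl
  rank-injective P zero    (suc y) Px Py same = ⊥-elim (here≢there (P zero) Px _ same)
  rank-injective P (suc x) zero    Px Py same = ⊥-elim (here≢there (P zero) Py _ (sym same))
  rank-injective P (suc x) (suc y) Px Py same =
    cong suc (rank-injective (P ∘ suc) x y Px Py (there-injective (P zero) same))

  injection⇒≤count : ∀ {k n} (P : Fin n → Bool) (g : Fin k → Fin n) →
    (∀ i j → g i ≡ g j → i ≡ j) → (∀ i → P (g i) ≡ true) → k ≤ count P
  injection⇒≤count {k} P g g-injective P∘g with k ≤? count P
  ... | yes k≤ = k≤
  ... | no  k≰ with pigeonhole (≰⇒> k≰) (λ i → rank P (g i) (P∘g i))
  ... | i , j , i<j , same-rank =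
    ⊥-elim (<⇒≢ i<j (g-injective i j (rank-injective P (g i) (g j) (P∘g i) (P∘g j) same-rank)))

module Graphs where

  open import Defs hiding (sym)
  open Counting
  open import Data.Bool using (Bool; true; false; T; _∧_; _∨_)
  open import Data.Bool.Properties using (∨-identityʳ; ∨-zeroʳ)
  open import Data.Empty using (⊥-elim)
  open import Data.Unit using (tt)
  open import Data.Fin using (Fin; toℕ; _≟_)
  open import Data.Fin.Properties using (toℕ-injective)
  open import Data.Nat using (ℕ; _+_; _*_; _<ᵇ_)
  open import Data.Nat.Properties using (+-identityʳ; <-asym; ≤-antisym; ≮⇒≥; <ᵇ⇒<; <⇒<ᵇ)
  open import Data.Product using (∃-syntax; _×_)
  open import Function using (_∘_)
  open import Relation.Nullary using (yes; no)
  open import Relation.Nullary.Decidable using (⌊_⌋; dec-true; isYes≗does)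
  open import Relation.Binary.PropositionalEquality

  ascendingAdj : ∀ {n} → Graph n → Fin n → Fin n → Bool
  ascendingAdj G i j = (toℕ i <ᵇ toℕ j) ∧ adj G i j

  indicator-adj : ∀ {n} (G : Graph n) i j →
    indicator (adj G i j) ≡ indicator (ascendingAdj G i j) + indicator (ascendingAdj G j i)
  indicator-adj G i j with toℕ i <ᵇ toℕ j in i<j | toℕ j <ᵇ toℕ i in j<i
  ... | true  | true  =
    ⊥-elim (<-asym (<ᵇ⇒< (toℕ i) (toℕ j) (subst T (sym i<j) tt)) (<ᵇ⇒< (toℕ j) (toℕ i) (subst T (sym j<i) tt)))
  ... | true  | false = sym (+-identityʳ _)
  ... | false | true  = cong indicator (Graph.sym G i j)
  ... | false | false = trans (cong (indicator ∘ adj G i) (sym i≡j)) (cong indicator (Graph.irrefl G i))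
    where
    i≡j : i ≡ j
    i≡j = toℕ-injective (≤-antisym (≮⇒≥ (subst T j<i ∘ <⇒<ᵇ)) (≮⇒≥ (subst T i<j ∘ <⇒<ᵇ)))

  handshake : ∀ {n} (G : Graph n) → 2 * edges G ≡ sumFin (degree G)
  handshake {n} G = sym (begin
    sumFin (degree G)
      ≡⟨ sumFin-cong (count≡sum-indicator ∘ adj G) ⟩
    sumFin (λ i → sumFin (λ j → indicator (adj G i j)))
      ≡⟨ sumFin-cong (λ i → sumFin-cong (indicator-adj G i)) ⟩
    sumFin (λ i → sumFin (λ j → up i j + up j i))
      ≡⟨ sumFin-cong (λ i → sumFin-+ (up i) (λ j → up j i)) ⟩
    sumFin (λ i → sumFin (up i) + sumFin (λ j → up j i))
      ≡⟨ sumFin-+ {n} _ _ ⟩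
    E + sumFin (λ i → sumFin (λ j → up j i))
      ≡⟨ cong (E +_) (sumFin-comm (λ j i → up i j)) ⟩
    E + E
      ≡⟨ cong (λ m → m + m) (sumFin-cong (count≡sum-indicator ∘ ascendingAdj G)) ⟨
    edges G + edges G
      ≡⟨ cong (edges G +_) (+-identityʳ _) ⟨
    2 * edges G ∎)
    where
    open ≡-Reasoning
    up : Fin n → Fin n → ℕ
    up i j = indicator (ascendingAdj G i j)
    E = sumFin (λ i → sumFin (up i))

  regular-handshake : ∀ {n} (G : Graph n) {d} → (∀ i → degree G i ≡ d) → 2 * edges G ≡ n * d
  regular-handshake {n} G {d} deg≡d = trans (handshake G) (trans (sumFin-cong deg≡d) (sumFin-const n d))

  Diameter≤2 : ∀ {n} → Graph n → Set
  Diameter≤2 {n} G =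
    ∀ (u v : Fin n) → u ≢ v → adj G u v ≡ false → ∃[ w ] adj G w u ≡ true × adj G w v ≡ true

  addEdge-away : ∀ {n} (a : Fin n → Fin n → Bool) {u v x} y → x ≢ u → x ≢ v →
    addEdge a u v x y ≡ true → a x y ≡ true
  addEdge-away a {u} {v} {x} y x≢u x≢v xy with x ≟ u | x ≟ v
  ... | yes x≡u | _       = ⊥-elim (x≢u x≡u)
  ... | no _    | yes x≡v = ⊥-elim (x≢v x≡v)
  ... | no _    | no _    = trans (sym (∨-identityʳ (a x y))) xy

  private
    ⌊≟⌋-refl : ∀ {n} (x : Fin n) → ⌊ x ≟ x ⌋ ≡ true
    ⌊≟⌋-refl x = trans (isYes≗does (x ≟ x)) (dec-true (x ≟ x) refl)

  addEdge-⊇ : ∀ {n} (a : Fin n → Fin n → Bool) u v {x y} → a x y ≡ true → addEdge a u v x y ≡ true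
  addEdge-⊇ a u v xy = cong (_∨ _) xy

  addEdge-uv : ∀ {n} (a : Fin n → Fin n → Bool) u v → addEdge a u v u v ≡ true
  addEdge-uv a u v rewrite ⌊≟⌋-refl u | ⌊≟⌋-refl v = ∨-zeroʳ (a u v)

  addEdge-vu : ∀ {n} (a : Fin n → Fin n → Bool) u v → addEdge a u v v u ≡ true
  addEdge-vu a u v rewrite ⌊≟⌋-refl u | ⌊≟⌋-refl v | ∨-zeroʳ (⌊ v ≟ u ⌋ ∧ ⌊ u ≟ v ⌋) =
    ∨-zeroʳ (a v u)

  addEdge-irrefl : ∀ {n} (a : Fin n → Fin n → Bool) {u v} x → u ≢ v → a x x ≡ false →
    addEdge a u v x x ≡ false
  addEdge-irrefl a {u} {v} x u≢v xx with x ≟ u | x ≟ v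
  ... | yes refl | yes refl = ⊥-elim (u≢v refl)
  ... | yes refl | no _     rewrite xx = refl
  ... | no _     | yes refl rewrite xx = refl
  ... | no _     | no _     rewrite xx = refl

module OversaturatedRegularGraphs where

  open import Defs hiding (sym)
  open Counting
  open Graphs using (addEdge-away)
  open import Data.Bool using (Bool; true; false; _∧_; not)
  open import Data.Bool.Properties using (∧-identityʳ; ∧-zeroʳ)
  open import Data.Fin using (Fin; zero; suc; _≟_; punchIn; punchOut)
  open import Data.Fin.Properties using (punchIn-injective; punchInᵢ≢i; punchIn-punchOut)
  open import Data.Nat using (ℕ; zero; suc; _+_; _*_; _≤_; z≤n)
  open import Data.Nat.Properties
    using (+-comm; +-suc; *-comm; *-zeroʳ; *-identityʳ; *-distribˡ-+; +-monoʳ-≤; ≤-trans; ≤-reflexive;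
           module ≤-Reasoning)
  open import Data.Product using (_,_)
  open import Function using (_∘_)
  open import Relation.Nullary using (does; yes; no)
  open import Relation.Binary.PropositionalEquality

  codegree : ∀ {n} → Graph n → Fin n → Fin n → ℕ
  codegree G u v = count (λ w → adj G u w ∧ adj G w v)

  nonNeighbourCount : ∀ {n} → Graph n → Fin n → ℕ
  nonNeighbourCount G u = count (λ v → not (adj G u v) ∧ not (does (v ≟ u)))

  cliqueThrough⇒≤codegree : ∀ {n} (G : Graph n) k {u v} → u ≢ v →
    CliqueThrough (addEdge (adj G) u v) (2 + k) u v → k ≤ codegree G u v
  cliqueThrough⇒≤codegree G k {u} {v} u≢v (f , f-injective , f-clique , (i , fi≡u) , (j , fj≡v)) =
    injection⇒≤count _ (f ∘ other) (λ x y → other-injective x y ∘ f-injective _ _) common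
    where
    i≢j : i ≢ j
    i≢j i≡j = u≢v (trans (sym fi≡u) (trans (cong f i≡j) fj≡v))
    -- the k positions of the clique other than i and j
    other : Fin k → Fin (2 + k)
    other x = punchIn i (punchIn (punchOut i≢j) x)
    other-injective : ∀ x y → other x ≡ other y → x ≡ y
    other-injective x y = punchIn-injective _ x y ∘ punchIn-injective i _ _
    other≢i : ∀ x → other x ≢ i
    other≢i x = punchInᵢ≢i i _
    other≢j : ∀ x → other x ≢ j
    other≢j x eq = punchInᵢ≢i (punchOut i≢j) x
      (punchIn-injective i _ _ (trans eq (sym (punchIn-punchOut i≢j))))
    f∘other≢u : ∀ x → f (other x) ≢ u
    f∘other≢u x eq = other≢i x (f-injective _ _ (trans eq (sym fi≡u)))
    f∘other≢v : ∀ x → f (other x) ≢ v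
    f∘other≢v x eq = other≢j x (f-injective _ _ (trans eq (sym fj≡v)))
    adjacent : ∀ x {w l} → f l ≡ w → l ≢ other x → adj G (f (other x)) w ≡ true
    adjacent x {w} refl l≢ = addEdge-away (adj G) w (f∘other≢u x) (f∘other≢v x) (f-clique _ _ (l≢ ∘ sym))
    common : ∀ x → (adj G u (f (other x)) ∧ adj G (f (other x)) v) ≡ true
    common x rewrite Graph.sym G u (f (other x))
                   | adjacent x fi≡u (other≢i x ∘ sym)
                   | adjacent x fj≡v (other≢j x ∘ sym) = refl

  oversaturated⇒≤codegree : ∀ {n} (G : Graph n) t → KOversaturated t G →
    ∀ {u v} → u ≢ v → adj G u v ≡ false → t ≤ codegree G u v
  oversaturated⇒≤codegree G t oversaturated {u} {v} u≢v ¬uv =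
    cliqueThrough⇒≤codegree G t u≢v
      (subst (λ m → CliqueThrough (addEdge (adj G) u v) m u v) (+-comm t 2) (oversaturated u v u≢v ¬uv))

  sumFin-codegree : ∀ {n} (G : Graph n) {d} → (∀ i → degree G i ≡ d) → ∀ u → sumFin (codegree G u) ≡ d * d
  sumFin-codegree {n} G {d} deg≡d u = begin
    sumFin (λ v → count (λ w → path w v))
      ≡⟨ sumFin-cong (λ v → count≡sum-indicator (λ w → path w v)) ⟩
    sumFin (λ v → sumFin (λ w → indicator (path w v)))
      ≡⟨ sumFin-comm {n} {n} _ ⟩
    sumFin (λ w → sumFin (λ v → indicator (path w v)))
      ≡⟨ sumFin-cong (λ w → count≡sum-indicator (path w)) ⟨
    sumFin (λ w → count (path w))
      ≡⟨ sumFin-cong (λ w → count-∧-indicator (adj G u w) (adj G w)) ⟩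
    sumFin (λ w → indicator (adj G u w) * degree G w)
      ≡⟨ sumFin-cong (λ w → trans (cong (indicator (adj G u w) *_) (deg≡d w)) (*-comm _ d)) ⟩
    sumFin (λ w → d * indicator (adj G u w))
      ≡⟨ sumFin-*ˡ {n} d _ ⟩
    d * sumFin (indicator ∘ adj G u)
      ≡⟨ cong (d *_) (trans (sym (count≡sum-indicator (adj G u))) (deg≡d u)) ⟩
    d * d ∎
    where
    open ≡-Reasoning
    path : Fin n → Fin n → Bool
    path w v = adj G u w ∧ adj G w v

  n≡1+degree+nonNeighbourCount : ∀ {n} (G : Graph n) u → n ≡ suc (degree G u) + nonNeighbourCount G u
  n≡1+degree+nonNeighbourCount {n} G u = begin
    n
      ≡⟨ count-true n ⟨
    count {n} (λ _ → true)
      ≡⟨ count-split (λ _ → true) (adj G u) ⟩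
    degree G u + count (not ∘ adj G u)
      ≡⟨ cong (degree G u +_) (count-split (not ∘ adj G u) (λ v → does (v ≟ u))) ⟩
    degree G u + (count (λ v → not (adj G u v) ∧ does (v ≟ u)) + s)
      ≡⟨ cong (λ m → degree G u + (m + s)) (trans (count-cong only-u) (count-≟ u)) ⟩
    degree G u + suc s
      ≡⟨ +-suc _ _ ⟩
    suc (degree G u) + s ∎
    where
    open ≡-Reasoning
    s = nonNeighbourCount G u
    only-u : ∀ v → (not (adj G u v) ∧ does (v ≟ u)) ≡ does (v ≟ u)
    only-u v with v ≟ u
    ... | yes refl = trans (∧-identityʳ _) (cong not (Graph.irrefl G v))
    ... | no  _    = ∧-zeroʳ _

  t*nonNeighbourCount≤sumFin-codegree : ∀ {n} (G : Graph n) t → KOversaturated t G →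
    ∀ u → t * nonNeighbourCount G u ≤ sumFin (codegree G u)
  t*nonNeighbourCount≤sumFin-codegree G t oversaturated u = begin
    t * nonNeighbourCount G u                      ≡⟨ cong (t *_) (count≡sum-indicator nonNeighbour) ⟩
    t * sumFin (indicator ∘ nonNeighbour)          ≡⟨ sumFin-*ˡ t (indicator ∘ nonNeighbour) ⟨
    sumFin (λ v → t * indicator (nonNeighbour v))  ≤⟨ sumFin-mono-≤ pointwise ⟩
    sumFin (codegree G u)                          ∎
    where
    open ≤-Reasoning
    nonNeighbour : Fin _ → Bool
    nonNeighbour v = not (adj G u v) ∧ not (does (v ≟ u))
    pointwise : ∀ v → t * indicator (nonNeighbour v) ≤ codegree G u v
    pointwise v with adj G u v in ¬uv | v ≟ u
    ... | true  | _       = ≤-trans (≤-reflexive (*-zeroʳ t)) z≤n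
    ... | false | yes _   = ≤-trans (≤-reflexive (*-zeroʳ t)) z≤n
    ... | false | no  v≢u =
      ≤-trans (≤-reflexive (*-identityʳ t)) (oversaturated⇒≤codegree G t oversaturated (v≢u ∘ sym) ¬uv)

  regular-oversaturated⇒t*n≤t*[1+d]+d² : ∀ {n} (G : Graph n) t {d} → KOversaturated t G →
    (∀ i → degree G i ≡ d) → t * n ≤ t * suc d + d * d
  regular-oversaturated⇒t*n≤t*[1+d]+d² {zero}  G t oversaturated deg≡d = ≤-trans (≤-reflexive (*-zeroʳ t)) z≤n
  regular-oversaturated⇒t*n≤t*[1+d]+d² {n@(suc _)} G t {d} oversaturated deg≡d = begin
    t * n                                 ≡⟨ cong (t *_) (n≡1+degree+nonNeighbourCount G zero) ⟩
    t * (suc (degree G zero) + s)         ≡⟨ cong (λ k → t * (suc k + s)) (deg≡d zero) ⟩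
    t * (suc d + s)                       ≡⟨ *-distribˡ-+ t (suc d) s ⟩
    t * suc d + t * s                     ≤⟨ +-monoʳ-≤ (t * suc d) ts≤paths ⟩
    t * suc d + sumFin (codegree G zero)  ≡⟨ cong (t * suc d +_) (sumFin-codegree G deg≡d zero) ⟩
    t * suc d + d * d                     ∎
    where
    open ≤-Reasoning
    s = nonNeighbourCount G zero
    ts≤paths : t * s ≤ sumFin (codegree G zero)
    ts≤paths = t*nonNeighbourCount≤sumFin-codegree G t oversaturated zero

module Arithmetic where

  open import Data.Nat using (ℕ; zero; suc; _+_; _*_; _^_; _≤_; _<_; z≤n; s≤s; NonZero; >-nonZero)
  open import Data.Nat.Properties
  open import Data.Nat.Tactic.RingSolver using (solve-∀)
  open import Data.Empty using (⊥-elim)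
  open import Relation.Nullary using (yes; no)
  open import Relation.Binary.PropositionalEquality

  -- The solver does not support _^_; the ring identities below spell x ^ 2 as its unfolding x * (x * 1).
  module _ {n e d} .{{_ : NonZero n}} (2e≡nd : 2 * e ≡ n * d) where

    private
      4e²B≡n²[d²B] : ∀ B → 4 * (e ^ 2 * B) ≡ n ^ 2 * (d * d * B)
      4e²B≡n²[d²B] B = begin
        4 * (e ^ 2 * B)         ≡⟨ ring₁ e B ⟩
        (2 * e) * (2 * e) * B   ≡⟨ cong (λ m → m * m * B) 2e≡nd ⟩
        (n * d) * (n * d) * B   ≡⟨ ring₂ n d B ⟩
        n ^ 2 * (d * d * B)     ∎
        where
        open ≡-Reasoning
        ring₁ : ∀ e B → 4 * (e * (e * 1) * B) ≡ (2 * e) * (2 * e) * B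
        ring₁ = solve-∀
        ring₂ : ∀ n d B → (n * d) * (n * d) * B ≡ n * (n * 1) * (d * d * B)
        ring₂ = solve-∀

      4a²n³≡n²[4a²n] : ∀ a → 4 * (a ^ 2 * n ^ 3) ≡ n ^ 2 * (4 * a ^ 2 * n)
      4a²n³≡n²[4a²n] a = ring a n
        where
        ring : ∀ a n → 4 * (a * (a * 1) * (n * (n * (n * 1)))) ≡ n * (n * 1) * (4 * (a * (a * 1)) * n)
        ring = solve-∀

    degree-lower⇒edges-lower : ∀ a B → 4 * a ^ 2 * n < d * d * B → a ^ 2 * n ^ 3 < e ^ 2 * B
    degree-lower⇒edges-lower a B ineq = *-cancelˡ-< 4 _ _ (subst₂ _<_
      (sym (4a²n³≡n²[4a²n] a)) (sym (4e²B≡n²[d²B] B)) (*-monoʳ-< (n ^ 2) {{m^n≢0 n 2}} ineq))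

    degree-upper⇒edges-upper : ∀ a B → d * d * B < 4 * a ^ 2 * n → e ^ 2 * B < a ^ 2 * n ^ 3
    degree-upper⇒edges-upper a B ineq = *-cancelˡ-< 4 _ _ (subst₂ _<_
      (sym (4e²B≡n²[d²B] B)) (sym (4a²n³≡n²[4a²n] a)) (*-monoʳ-< (n ^ 2) {{m^n≢0 n 2}} ineq))

  n≤T[1+d]⇒c*n<d*d : ∀ T c n d → 4 * T * T * c + T < n → n ≤ T * suc d → c * n < d * d
  n≤T[1+d]⇒c*n<d*d T c n zero N<n n≤T*1 =
    ⊥-elim (<-irrefl refl (<-≤-trans (≤-<-trans (m≤n+m T _) N<n) (≤-trans n≤T*1 (≤-reflexive (*-identityʳ T)))))
  n≤T[1+d]⇒c*n<d*d T c n d@(suc d′) N<n n≤T[1+d] = *-cancelˡ-< (4 * T * T) _ _ (begin-strict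
    4 * T * T * (c * n)        ≡⟨ *-assoc (4 * T * T) c n ⟨
    4 * T * T * c * n          <⟨ *-monoˡ-< n {{>-nonZero (≤-<-trans z≤n N<n)}} (≤-<-trans (m≤m+n _ T) N<n) ⟩
    n * n                      ≤⟨ *-mono-≤ n≤2Td n≤2Td ⟩
    (2 * T * d) * (2 * T * d)  ≡⟨ ring T d ⟩
    4 * T * T * (d * d)        ∎)
    where
    open ≤-Reasoning
    ring : ∀ T d → (2 * T * d) * (2 * T * d) ≡ 4 * T * T * (d * d)
    ring = solve-∀
    ring′ : ∀ T d′ → T * (suc d′ + suc d′) ≡ 2 * T * suc d′
    ring′ = solve-∀
    n≤2Td : n ≤ 2 * T * d
    n≤2Td = ≤-trans n≤T[1+d] (≤-trans (*-monoʳ-≤ T (s≤s (m≤n+m d d′))) (≤-reflexive (ring′ T d′)))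

  t*n≤t*[1+d]+d²⇒c*n<d*d*B : ∀ t B c n d → .{{NonZero B}} → c < t * B →
    t * n ≤ t * suc d + d * d → 4 * (t * B) * (t * B) * c + t * B < n → c * n < d * d * B
  t*n≤t*[1+d]+d²⇒c*n<d*d*B t B c n d c<T tn≤ N<n with t * B * suc d <? n
  ... | yes T[1+d]<n = +-cancelˡ-< n _ _ (begin-strict
    n + c * n                    ≤⟨ *-monoˡ-≤ n c<T ⟩
    t * B * n                    ≡⟨ ring t B n ⟩
    t * n * B                    ≤⟨ *-monoˡ-≤ B tn≤ ⟩
    (t * suc d + d * d) * B      ≡⟨ ring′ t d B ⟩
    t * B * suc d + d * d * B    <⟨ +-monoˡ-< (d * d * B) T[1+d]<n ⟩
    n + d * d * B                ∎)
    where
    open ≤-Reasoning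
    ring : ∀ t B n → t * B * n ≡ t * n * B
    ring = solve-∀
    ring′ : ∀ t d B → (t * suc d + d * d) * B ≡ t * B * suc d + d * d * B
    ring′ = solve-∀
  ... | no  T[1+d]≮n = <-≤-trans (n≤T[1+d]⇒c*n<d*d (t * B) c n d N<n (≮⇒≥ T[1+d]≮n)) (m≤m*n (d * d) B)

  planeSize : ℕ → ℕ
  planeSize p = p * p + (p + 1)

  p≤planeSize : ∀ p → p ≤ planeSize p
  p≤planeSize p = ≤-trans (m≤m+n p 1) (m≤n+m (p + 1) (p * p))

  planeSize-nonZero : ∀ p → NonZero (planeSize p)
  planeSize-nonZero p = >-nonZero (≤-trans (m≤n+m 1 p) (m≤n+m (p + 1) (p * p)))

  T*[p+2]²≤[1+T]*planeSize : ∀ T p → 3 * T ≤ p → T * ((p + 2) * (p + 2)) ≤ suc T * planeSize p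
  T*[p+2]²≤[1+T]*planeSize T p 3T≤p = begin
    T * ((p + 2) * (p + 2))                ≡⟨ ring T p ⟩
    T * planeSize p + (3 * T * p + 3 * T)  ≤⟨ +-monoʳ-≤ (T * planeSize p) 3T[p+1]≤planeSize ⟩
    T * planeSize p + planeSize p          ≡⟨ +-comm (T * planeSize p) (planeSize p) ⟩
    suc T * planeSize p                    ∎
    where
    open ≤-Reasoning
    ring : ∀ T p → T * ((p + 2) * (p + 2)) ≡ T * (p * p + (p + 1)) + (3 * T * p + 3 * T)
    ring = solve-∀
    3T[p+1]≤planeSize : 3 * T * p + 3 * T ≤ planeSize p
    3T[p+1]≤planeSize = +-mono-≤ (*-monoˡ-≤ p 3T≤p) (≤-trans 3T≤p (m≤m+n p 1))

  d<t*[p+2]⇒d*d*B<c*[planeSize*t] : ∀ t B c p d → .{{NonZero B}} → 3 * (t * B) ≤ p → t * B < c →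
    d < t * (p + 2) → d * d * B < c * (planeSize p * t)
  d<t*[p+2]⇒d*d*B<c*[planeSize*t] t B c p d 3T≤p T<c d<t[p+2] = begin-strict
    d * d * B                              <⟨ *-monoˡ-< B (*-mono-< d<t[p+2] d<t[p+2]) ⟩
    (t * (p + 2)) * (t * (p + 2)) * B      ≡⟨ ring t p B ⟩
    t * (t * B * ((p + 2) * (p + 2)))      ≤⟨ *-monoʳ-≤ t (T*[p+2]²≤[1+T]*planeSize (t * B) p 3T≤p) ⟩
    t * (suc (t * B) * planeSize p)        ≤⟨ *-monoʳ-≤ t (*-monoˡ-≤ (planeSize p) T<c) ⟩
    t * (c * planeSize p)                  ≡⟨ ring′ t c (planeSize p) ⟩
    c * (planeSize p * t)                  ∎
    where
    open ≤-Reasoning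
    ring : ∀ t p B → (t * (p + 2)) * (t * (p + 2)) * B ≡ t * (t * B * ((p + 2) * (p + 2)))
    ring = solve-∀
    ring′ : ∀ t c N → t * (c * N) ≡ c * (N * t)
    ring′ = solve-∀

module BlowUp where

  open import Defs hiding (sym)
  open Counting
  open Graphs
  open import Data.Nat using (ℕ; suc; _+_; _*_)
  open import Data.Nat.Properties using (*-comm; *-identityʳ)
  open import Data.Bool using (Bool; true; false; _∧_; _∨_; not)
  open import Data.Bool.Properties using (∧-zeroʳ; ∨-zeroʳ; ∨-conicalʳ)
  open import Data.Empty using (⊥-elim)
  open import Data.Fin using (Fin; zero; suc; _≟_; combine; remQuot; splitAt; _↑ʳ_; join)
  open import Data.Fin.Properties using (remQuot-combine; combine-remQuot; splitAt-↑ʳ; join-splitAt)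
  open import Data.Product using (_,_; proj₁; proj₂)
  open import Data.Sum using (_⊎_; inj₁; inj₂)
  open import Function using (_∘_)
  open import Function.Bundles using (mk⇔)
  open import Relation.Nullary using (does; yes; no)
  open import Relation.Nullary.Decidable using (dec-true; dec-false; does-⇔)
  open import Relation.Binary.PropositionalEquality

  module _ {m} (H : Graph m) (t : ℕ) where

    bag : Fin (m * t) → Fin m
    bag = proj₁ ∘ remQuot {m} t

    slot : Fin (m * t) → Fin t
    slot = proj₂ ∘ remQuot {m} t

    blowUpAdj : Fin (m * t) → Fin (m * t) → Bool
    blowUpAdj i j = (does (bag j ≟ bag i) ∧ not (does (slot j ≟ slot i))) ∨ adj H (bag i) (bag j)

    blowUpAdj-sym : ∀ i j → blowUpAdj i j ≡ blowUpAdj j i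
    blowUpAdj-sym i j = cong₂ _∨_ (cong₂ _∧_ (≟-sym (bag j) (bag i)) (cong not (≟-sym (slot j) (slot i))))
                                  (Graph.sym H (bag i) (bag j))
      where
      ≟-sym : ∀ {n} (a b : Fin n) → does (a ≟ b) ≡ does (b ≟ a)
      ≟-sym a b = does-⇔ (mk⇔ sym sym) (a ≟ b) (b ≟ a)

    blowUpAdj-irrefl : ∀ i → blowUpAdj i i ≡ false
    blowUpAdj-irrefl i rewrite dec-true (slot i ≟ slot i) refl | ∧-zeroʳ (does (bag i ≟ bag i)) =
      Graph.irrefl H (bag i)

    blowUp : Graph (m * t)
    blowUp = record { adj = blowUpAdj ; sym = blowUpAdj-sym ; irrefl = blowUpAdj-irrefl }

    bag-combine : ∀ b s → bag (combine b s) ≡ b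
    bag-combine b s = cong proj₁ (remQuot-combine {m} {t} b s)

    slot-combine : ∀ b s → slot (combine b s) ≡ s
    slot-combine b s = cong proj₂ (remQuot-combine {m} {t} b s)

    bag-slot-injective : ∀ {u v} → bag u ≡ bag v → slot u ≡ slot v → u ≡ v
    bag-slot-injective {u} {v} bag≡ slot≡ =
      trans (sym (combine-remQuot {m} t u)) (trans (cong₂ combine bag≡ slot≡) (combine-remQuot {m} t v))

    blowUpAdj-combine : ∀ i b s →
      blowUpAdj i (combine b s) ≡ (does (b ≟ bag i) ∧ not (does (s ≟ slot i))) ∨ adj H (bag i) b
    blowUpAdj-combine i b s rewrite bag-combine b s | slot-combine b s = refl

    same-bag⇒adjacent : ∀ {u v} → u ≢ v → bag u ≡ bag v → blowUpAdj u v ≡ true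
    same-bag⇒adjacent {u} {v} u≢v bag≡
      rewrite dec-true (bag v ≟ bag u) (sym bag≡)
            | dec-false (slot v ≟ slot u) (u≢v ∘ bag-slot-injective bag≡ ∘ sym) = refl

    adjacent-bags⇒adjacent : ∀ {i j} → adj H (bag i) (bag j) ≡ true → blowUpAdj i j ≡ true
    adjacent-bags⇒adjacent {i} {j} ij =
      trans (cong (does (bag j ≟ bag i) ∧ not (does (slot j ≟ slot i)) ∨_) ij) (∨-zeroʳ _)

  blowUp-degree : ∀ {m} (H : Graph m) t {k} → (∀ x → degree H x ≡ k) →
    ∀ i → degree (blowUp H (suc t)) i ≡ t + suc t * k
  blowUp-degree {m} H t {k} deg≡k i = begin
    count (blowUpAdj H T i)
      ≡⟨ count-combine m (blowUpAdj H T i) ⟩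
    sumFin (λ b → count (λ s → blowUpAdj H T i (combine {m} {T} b s)))
      ≡⟨ sumFin-cong (λ b → count-cong (blowUpAdj-combine H T i b)) ⟩
    sumFin (λ b → count (λ s → sameBag b s ∨ adj H u b))
      ≡⟨ sumFin-cong (λ b → count-∨-disjoint (sameBag b) (λ _ → adj H u b) (disjoint b)) ⟩
    sumFin (λ b → count (sameBag b) + count {T} (λ _ → adj H u b))
      ≡⟨ sumFin-+ {m} _ _ ⟩
    sumFin (λ b → count (sameBag b)) + sumFin (λ b → count {T} (λ _ → adj H u b))
      ≡⟨ cong₂ _+_ ownBag otherBags ⟩
    t + T * k ∎
    where
    open ≡-Reasoning
    T = suc t
    u = bag H T i
    sameBag : Fin m → Fin T → Bool
    sameBag b s = does (b ≟ u) ∧ not (does (s ≟ slot H T i))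
    disjoint : ∀ b s → (does (b ≟ u) ∧ not (does (s ≟ slot H T i))) ∧ adj H u b ≡ false
    disjoint b s with b ≟ u
    ... | yes refl = trans (cong (_ ∧_) (Graph.irrefl H b)) (∧-zeroʳ _)
    ... | no  _    = refl
    ownBag : sumFin (λ b → count (sameBag b)) ≡ t
    ownBag = begin
      sumFin (λ b → count (sameBag b))
        ≡⟨ sumFin-cong (λ b → count-∧-indicator (does (b ≟ u)) (λ s → not (does (s ≟ slot H T i)))) ⟩
      sumFin (λ b → indicator (does (b ≟ u)) * count (λ s → not (does (s ≟ slot H T i))))
        ≡⟨ sumFin-cong (λ b → trans (cong (indicator (does (b ≟ u)) *_) (count-≢ (slot H T i))) (*-comm _ t)) ⟩
      sumFin (λ b → t * indicator (does (b ≟ u)))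
        ≡⟨ sumFin-*ˡ t (λ b → indicator (does (b ≟ u))) ⟩
      t * sumFin (λ b → indicator (does (b ≟ u)))
        ≡⟨ cong (t *_) (trans (sym (count≡sum-indicator (λ b → does (b ≟ u)))) (count-≟ u)) ⟩
      t * 1
        ≡⟨ *-identityʳ t ⟩
      t ∎
    otherBags : sumFin (λ b → count {T} (λ _ → adj H u b)) ≡ T * k
    otherBags = begin
      sumFin (λ b → count {T} (λ _ → adj H u b))  ≡⟨ sumFin-cong (λ b → count-const T (adj H u b)) ⟩
      sumFin (λ b → T * indicator (adj H u b))    ≡⟨ sumFin-*ˡ T (indicator ∘ adj H u) ⟩
      T * sumFin (indicator ∘ adj H u)            ≡⟨ cong (T *_) (sym (count≡sum-indicator (adj H u))) ⟩
      T * degree H u                              ≡⟨ cong (T *_) (deg≡k u) ⟩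
      T * k                                       ∎

  -- The bag of a common neighbour w of the bags of u and v, together with u and v, is a K_{t+2}.
  module _ {m} (H : Graph m) (t : ℕ) {u v w} (u≢v : u ≢ v)
           (wu : adj H w (bag H t u) ≡ true) (wv : adj H w (bag H t v) ≡ true) where

    private
      B = blowUp H t
      G+uv = addEdge (adj B) u v

    member : Fin t ⊎ Fin 2 → Fin (m * t)
    member (inj₁ s)          = combine w s
    member (inj₂ zero)       = u
    member (inj₂ (suc zero)) = v

    bag-member-adjacent : ∀ s x → adj H w (bag H t x) ≡ true → adj B (member (inj₁ s)) x ≡ true
    bag-member-adjacent s x wx =
      adjacent-bags⇒adjacent H t (trans (cong (λ b → adj H b (bag H t x)) (bag-combine H t w s)) wx)

    members-adjacent : ∀ a b → a ≢ b → G+uv (member a) (member b) ≡ true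
    members-adjacent (inj₁ s) (inj₁ s′) s≢s′ =
      addEdge-⊇ (adj B) u v (same-bag⇒adjacent H t slots-differ (trans (bag-combine H t w s) (sym (bag-combine H t w s′))))
      where
      slots-differ : combine w s ≢ combine w s′
      slots-differ eq =
        s≢s′ (cong inj₁ (trans (sym (slot-combine H t w s)) (trans (cong (slot H t) eq) (slot-combine H t w s′))))
    members-adjacent (inj₁ s)          (inj₂ zero)       _ = addEdge-⊇ (adj B) u v (bag-member-adjacent s u wu)
    members-adjacent (inj₁ s)          (inj₂ (suc zero)) _ = addEdge-⊇ (adj B) u v (bag-member-adjacent s v wv)
    members-adjacent (inj₂ zero)       (inj₁ s)          _ =
      addEdge-⊇ (adj B) u v (trans (Graph.sym B u _) (bag-member-adjacent s u wu))
    members-adjacent (inj₂ (suc zero)) (inj₁ s)          _ =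
      addEdge-⊇ (adj B) u v (trans (Graph.sym B v _) (bag-member-adjacent s v wv))
    members-adjacent (inj₂ zero)       (inj₂ zero)       a≢a = ⊥-elim (a≢a refl)
    members-adjacent (inj₂ zero)       (inj₂ (suc zero)) _   = addEdge-uv (adj B) u v
    members-adjacent (inj₂ (suc zero)) (inj₂ zero)       _   = addEdge-vu (adj B) u v
    members-adjacent (inj₂ (suc zero)) (inj₂ (suc zero)) a≢a = ⊥-elim (a≢a refl)

    clique : CliqueThrough G+uv (t + 2) u v
    clique = member ∘ splitAt t , f-injective , f-clique , (t ↑ʳ zero , cong member (splitAt-↑ʳ t 2 zero))
                                                       , (t ↑ʳ suc zero , cong member (splitAt-↑ʳ t 2 (suc zero)))
      where
      splitAt-injective : ∀ {i j} → splitAt t i ≡ splitAt t j → i ≡ j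
      splitAt-injective {i} {j} eq = trans (sym (join-splitAt t 2 i)) (trans (cong (join t 2) eq) (join-splitAt t 2 j))
      f-clique : ∀ i j → i ≢ j → G+uv (member (splitAt t i)) (member (splitAt t j)) ≡ true
      f-clique i j i≢j = members-adjacent (splitAt t i) (splitAt t j) (i≢j ∘ splitAt-injective)
      f-injective : ∀ i j → member (splitAt t i) ≡ member (splitAt t j) → i ≡ j
      f-injective i j eq with i ≟ j
      ... | yes i≡j = i≡j
      ... | no  i≢j with () ← trans (sym (f-clique i j i≢j))
                                     (trans (cong (G+uv _) (sym eq)) (addEdge-irrefl (adj B) _ u≢v (Graph.irrefl B _)))

  blowUp-oversaturated : ∀ {m} (H : Graph m) t → Diameter≤2 H → KOversaturated t (blowUp H t)
  blowUp-oversaturated H t diameter≤2 u v u≢v ¬uv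
    with diameter≤2 (bag H t u) (bag H t v) bags-differ (∨-conicalʳ _ _ ¬uv)
    where
    bags-differ : bag H t u ≢ bag H t v
    bags-differ bag≡ with () ← trans (sym (same-bag⇒adjacent H t u≢v bag≡)) ¬uv
  ... | w , wu , wv = clique H t u≢v wu wv

-- 𝔽ₚ is modelled by ℤ with equality up to divisibility by P = + p; Fin p supplies the canonical
-- representatives ι r, and residue picks the representative of an integer.
module ZMod {p : ℕ} (p-prime : Prime p) (2<p : 2 < p) where

  open import Defs using (count)
  open Counting using (count-unique; does-sound)
  import Data.Nat as ℕ
  import Data.Nat.Properties as ℕ
  import Data.Nat.Divisibility as ℕ
  open import Data.Nat.Primality using (euclidsLemma; prime⇒nonZero)
  open import Data.Nat.Coprimality using (prime⇒coprime; coprime-Bézout)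
  open import Data.Nat.GCD using (module Bézout)
  open import Data.Integer using (ℤ; +_; -_; _+_; _*_; _-_; _%ℕ_; _/ℕ_)
  import Data.Integer as ℤ
  open import Data.Integer.Properties using (abs-*; pos-+; pos-*; ⊖-≥; [+m]-[+n]≡m⊖n; +-identityˡ)
  open import Data.Integer.Divisibility.Signed
  open import Data.Integer.DivMod using (n%ℕd<d; a≡a%ℕn+[a/ℕn]*n)
  open import Data.Integer.Tactic.RingSolver using (solve-∀)
  open import Data.Bool using (Bool; true; false)
  open import Data.Empty using (⊥-elim)
  open import Data.Fin using (Fin; toℕ; fromℕ<)
  open import Data.Fin.Properties using (toℕ-injective; toℕ<n; toℕ-fromℕ<)
  open import Data.Product using (∃-syntax; _,_)
  open import Data.Sum using (_⊎_; inj₁; inj₂; [_,_]′; map)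
  open import Function using (_∘_; id)
  open import Relation.Nullary using (¬_; does)
  open import Relation.Nullary.Decidable using (dec-true; dec-false)
  open import Relation.Binary.PropositionalEquality

  private instance
    p≢0 : ℕ.NonZero p
    p≢0 = prime⇒nonZero p-prime

  P : ℤ
  P = + p

  -- Opaque so that unification never unfolds the decision procedure for divisibility.
  opaque
    vanishes : ℤ → Bool
    vanishes x = does (P ∣? x)

    vanishes-complete : ∀ {x} → P ∣ x → vanishes x ≡ true
    vanishes-complete = dec-true (P ∣? _)

    vanishes-false : ∀ {x} → ¬ P ∣ x → vanishes x ≡ false
    vanishes-false = dec-false (P ∣? _)

    vanishes-sound : ∀ {x} → vanishes x ≡ true → P ∣ x
    vanishes-sound = does-sound (P ∣? _)

  P∣+k⇒k≡0 : ∀ {k} → k < p → P ∣ + k → k ≡ 0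
  P∣+k⇒k≡0 {ℕ.zero}  k<p P∣k = refl
  P∣+k⇒k≡0 {ℕ.suc k} k<p P∣k = ⊥-elim (ℕ.<-irrefl refl (ℕ.<-≤-trans k<p (ℕ.∣⇒≤ (∣⇒∣ᵤ P∣k))))

  P∤1 : ¬ P ∣ + 1
  P∤1 P∣1 with () ← P∣+k⇒k≡0 {1} (ℕ.<-trans (ℕ.n<1+n 1) 2<p) P∣1

  P∤2 : ¬ P ∣ + 2
  P∤2 P∣2 with () ← P∣+k⇒k≡0 {2} 2<p P∣2

  euclid : ∀ {x y} → P ∣ x * y → P ∣ x ⊎ P ∣ y
  euclid {x} {y} P∣xy =
    map ∣ᵤ⇒∣ ∣ᵤ⇒∣ (euclidsLemma ℤ.∣ x ∣ ℤ.∣ y ∣ p-prime (subst (p ℕ.∣_) (abs-* x y) (∣⇒∣ᵤ P∣xy)))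

  P∣c*x⇒P∣x : ∀ {c x} → ¬ P ∣ c → P ∣ c * x → P ∣ x
  P∣c*x⇒P∣x P∤c P∣cx = [ ⊥-elim ∘ P∤c , id ]′ (euclid P∣cx)

  P∣x*x⇒P∣x : ∀ {x} → P ∣ x * x → P ∣ x
  P∣x*x⇒P∣x P∣xx = [ id , id ]′ (euclid P∣xx)

  ι : Fin p → ℤ
  ι r = + toℕ r

  residue : ℤ → Fin p
  residue x = fromℕ< (n%ℕd<d x p)

  P∣x-residue : ∀ x → P ∣ x - ι (residue x)
  P∣x-residue x = divides (x /ℕ p) (begin
    x - ι (residue x)                          ≡⟨ cong (λ r → x - + r) (toℕ-fromℕ< (n%ℕd<d x p)) ⟩
    x - + (x %ℕ p)                             ≡⟨ cong (_- + (x %ℕ p)) (a≡a%ℕn+[a/ℕn]*n x p) ⟩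
    + (x %ℕ p) + (x /ℕ p) * P - + (x %ℕ p)     ≡⟨ ring (+ (x %ℕ p)) ((x /ℕ p) * P) ⟩
    (x /ℕ p) * P                               ∎)
    where
    open ≡-Reasoning
    ring : ∀ a b → a + b - a ≡ b
    ring = solve-∀

  P∣residue-x : ∀ x → P ∣ ι (residue x) - x
  P∣residue-x x = subst (P ∣_) (ring x (ι (residue x))) (∣m⇒∣-m (P∣x-residue x))
    where
    ring : ∀ a b → - (a - b) ≡ b - a
    ring = solve-∀

  private
    ordered-P∣ι-ι⇒≡ : ∀ {r s} → toℕ s ℕ.≤ toℕ r → P ∣ ι r - ι s → toℕ r ≡ toℕ s
    ordered-P∣ι-ι⇒≡ {r} {s} s≤r P∣r-s = ℕ.≤-antisym (ℕ.m∸n≡0⇒m≤n r∸s≡0) s≤r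
      where
      r∸s≡0 : toℕ r ℕ.∸ toℕ s ≡ 0
      r∸s≡0 = P∣+k⇒k≡0 (ℕ.≤-<-trans (ℕ.m∸n≤m (toℕ r) (toℕ s)) (toℕ<n r))
                        (subst (P ∣_) (trans ([+m]-[+n]≡m⊖n (toℕ r) (toℕ s)) (⊖-≥ s≤r)) P∣r-s)

  P∣ι-ι⇒≡ : ∀ r s → P ∣ ι r - ι s → r ≡ s
  P∣ι-ι⇒≡ r s P∣r-s with ℕ.≤-total (toℕ s) (toℕ r)
  ... | inj₁ s≤r = toℕ-injective (ordered-P∣ι-ι⇒≡ s≤r P∣r-s)
  ... | inj₂ r≤s =
    sym (toℕ-injective (ordered-P∣ι-ι⇒≡ r≤s (subst (P ∣_) (ring (ι r) (ι s)) (∣m⇒∣-m P∣r-s))))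
    where
    ring : ∀ a b → - (a - b) ≡ b - a
    ring = solve-∀

  0ₚ : Fin p
  0ₚ = fromℕ< (ℕ.<-trans (ℕ.n<1+n 0) (ℕ.<-trans (ℕ.n<1+n 1) 2<p))

  ι0ₚ≡0 : ι 0ₚ ≡ + 0
  ι0ₚ≡0 = cong +_ (toℕ-fromℕ< _)

  P∣0 : P ∣ + 0
  P∣0 = divides (+ 0) refl

  P∣ι⇒≡0ₚ : ∀ r → P ∣ ι r → r ≡ 0ₚ
  P∣ι⇒≡0ₚ r P∣r = P∣ι-ι⇒≡ r 0ₚ (subst (P ∣_) r≡r-0 P∣r)
    where
    ring : ∀ a → a - + 0 ≡ a
    ring = solve-∀
    r≡r-0 : ι r ≡ ι r - ι 0ₚ
    r≡r-0 = sym (trans (cong (λ m → ι r - m) ι0ₚ≡0) (ring (ι r)))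

  negate : Fin p → Fin p
  negate y = residue (- ι y)

  P∣negate[y]+y : ∀ y → P ∣ ι (negate y) + ι y
  P∣negate[y]+y y = subst (P ∣_) (ring (ι y) (ι (negate y))) (∣m⇒∣-m (P∣x-residue (- ι y)))
    where
    ring : ∀ a b → - (- a - b) ≡ b + a
    ring = solve-∀

  negate-involutive : ∀ y → negate (negate y) ≡ y
  negate-involutive y = P∣ι-ι⇒≡ _ _ (subst (P ∣_) (ring (ι (negate (negate y))) (ι (negate y)) (ι y))
    (∣m∣n⇒∣m-n (P∣negate[y]+y (negate y)) (P∣negate[y]+y y)))
    where
    ring : ∀ a b c → (a + b) - (b + c) ≡ a - c
    ring = solve-∀

  negate-≢0ₚ : ∀ {y} → y ≢ 0ₚ → negate y ≢ 0ₚ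
  negate-≢0ₚ {y} y≢0 -y≡0 = y≢0 (P∣ι⇒≡0ₚ y (subst (P ∣_) -y+y≡y (P∣negate[y]+y y)))
    where
    -y+y≡y : ι (negate y) + ι y ≡ ι y
    -y+y≡y = trans (cong (λ m → ι m + ι y) -y≡0) (trans (cong (_+ ι y) ι0ₚ≡0) (+-identityˡ (ι y)))

  private
    lift-Bézout : ∀ u v w z → 1 ℕ.+ u ℕ.* v ≡ w ℕ.* z → + 1 + + u * + v ≡ + w * + z
    lift-Bézout u v w z eq = begin
      + 1 + + u * + v    ≡⟨ cong (λ m → + 1 + m) (pos-* u v) ⟨
      + 1 + + (u ℕ.* v)  ≡⟨ pos-+ 1 (u ℕ.* v) ⟨
      + (1 ℕ.+ u ℕ.* v)  ≡⟨ cong +_ eq ⟩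
      + (w ℕ.* z)        ≡⟨ pos-* w z ⟩
      + w * + z          ∎
      where open ≡-Reasoning

    inverse-via-residue : ∀ x r → P ∣ x - ι r → .{{ℕ.NonZero (toℕ r)}} → ∃[ y ] P ∣ x * y - + 1
    inverse-via-residue x r P∣x-r with coprime-Bézout (prime⇒coprime p-prime (toℕ<n r))
    ... | Bézout.+- a b 1+br≡ap = - + b ,
      subst (P ∣_) (ring x (ι r) (+ b)) (∣m⇒∣-m (∣m∣n⇒∣m+n P∣1+br (∣n⇒∣m*n (+ b) P∣x-r)))
      where
      P∣1+br : P ∣ + 1 + + b * ι r
      P∣1+br = subst (P ∣_) (sym (lift-Bézout b (toℕ r) a p 1+br≡ap)) (∣n⇒∣m*n (+ a) ∣-refl)
      ring : ∀ x r b → - ((+ 1 + b * r) + b * (x - r)) ≡ x * - b - + 1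
      ring = solve-∀
    ... | Bézout.-+ a b 1+ap≡br = + b ,
      subst (P ∣_) (ring x (ι r) (+ b)) (∣m∣n⇒∣m+n P∣br-1 (∣n⇒∣m*n (+ b) P∣x-r))
      where
      P∣br-1 : P ∣ + b * ι r - + 1
      P∣br-1 = subst (λ m → P ∣ m - + 1) (lift-Bézout a p b (toℕ r) 1+ap≡br)
                     (subst (P ∣_) (ring′ (+ a * P)) (∣n⇒∣m*n (+ a) ∣-refl))
        where
        ring′ : ∀ m → m ≡ + 1 + m - + 1
        ring′ = solve-∀
      ring : ∀ x r b → (b * r - + 1) + b * (x - r) ≡ x * b - + 1
      ring = solve-∀

  inverse : ∀ x → ¬ P ∣ x → ∃[ y ] P ∣ x * y - + 1
  inverse x P∤x = inverse-via-residue x (residue x) (P∣x-residue x) {{ℕ.≢-nonZero residue≢0}}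
    where
    ring : ∀ x → x - + 0 ≡ x
    ring = solve-∀
    residue≢0 : toℕ (residue x) ≢ 0
    residue≢0 r≡0 = P∤x (subst (P ∣_) (ring x) (subst (λ k → P ∣ x - + k) r≡0 (P∣x-residue x)))

  linear-root-unique : ∀ c e → ¬ P ∣ c → count {p} (λ r → vanishes (c * ι r + e)) ≡ 1
  linear-root-unique c e P∤c with inverse c P∤c
  ... | y , P∣cy-1 = count-unique _ r₀ (vanishes-complete P∣root) unique
    where
    r₀ = residue (- (e * y))
    ring₁ : ∀ c e y r → c * (r - - (e * y)) - e * (c * y - + 1) ≡ c * r + e
    ring₁ = solve-∀
    ring₂ : ∀ c e r s → (c * r + e) - (c * s + e) ≡ c * (r - s)
    ring₂ = solve-∀
    P∣root : P ∣ c * ι r₀ + e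
    P∣root = subst (P ∣_) (ring₁ c e y (ι r₀))
      (∣m∣n⇒∣m-n (∣n⇒∣m*n c (P∣residue-x (- (e * y)))) (∣n⇒∣m*n e P∣cy-1))
    unique : ∀ r → vanishes (c * ι r + e) ≡ true → r ≡ r₀
    unique r root = P∣ι-ι⇒≡ r r₀ (P∣c*x⇒P∣x P∤c (subst (P ∣_) (ring₂ c e (ι r) (ι r₀))
      (∣m∣n⇒∣m-n (vanishes-sound {c * ι r + e} root) P∣root)))

module PolarityGraph {p : ℕ} (p-prime : Prime p) (2<p : 2 < p) where

  open import Defs using (Graph; degree; count; sumFin)
  open Graphs using (Diameter≤2)
  open Counting
  open Arithmetic using (planeSize)
  open ZMod p-prime 2<p
  import Data.Nat as ℕ
  import Data.Nat.Properties as ℕ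
  open import Data.Integer using (ℤ; +_; -_; _+_; _*_; _-_)
  open import Data.Integer.Divisibility.Signed
  open import Data.Integer.Tactic.RingSolver using (solve-∀)
  open import Data.Bool using (Bool; true; false; _∧_; _∨_; not)
  open import Data.Bool.Properties using (∧-conicalˡ; ∧-conicalʳ; ∧-zeroʳ; ⇔→≡)
  open import Function.Bundles using (mk⇔)
  open import Data.Empty using (⊥; ⊥-elim)
  open import Data.Fin using (Fin; zero; _≟_; _↑ˡ_; _↑ʳ_; combine; remQuot; splitAt)
  open import Data.Fin.Properties
    using (splitAt-↑ˡ; splitAt-↑ʳ; remQuot-combine; combine-remQuot; splitAt⁻¹-↑ˡ; splitAt⁻¹-↑ʳ)
  open import Data.Product using (∃-syntax; _×_; _,_; uncurry)
  open import Data.Sum using (_⊎_; inj₁; inj₂; map₂)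
  open import Function using (_∘_)
  open import Relation.Binary.Definitions using (DecidableEquality)
  open import Relation.Nullary using (¬_; does; yes; no)
  open import Relation.Nullary.Decidable using (map′; dec-true; dec-false; does-⇔)
  open import Relation.Binary.PropositionalEquality

  data Point : Set where
    [1∶_∶_] : Fin p → Fin p → Point
    [0∶1∶_] : Fin p → Point
    [0∶0∶1] : Point

  c₀ c₁ c₂ : Point → ℤ
  c₀ [1∶ _ ∶ _ ] = + 1
  c₀ [0∶1∶ _ ]   = + 0
  c₀ [0∶0∶1]     = + 0
  c₁ [1∶ y ∶ _ ] = ι y
  c₁ [0∶1∶ _ ]   = + 1
  c₁ [0∶0∶1]     = + 0
  c₂ [1∶ _ ∶ z ] = ι z
  c₂ [0∶1∶ z ]   = ι z
  c₂ [0∶0∶1]     = + 1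

  form : Point → Point → ℤ
  form x y = c₀ x * c₂ y + c₁ x * c₁ y + c₂ x * c₀ y

  private
    fromSum : Fin (p ℕ.* p) ⊎ (Fin p ⊎ Fin 1) → Point
    fromSum (inj₁ k)        = uncurry [1∶_∶_] (remQuot p k)
    fromSum (inj₂ (inj₁ z)) = [0∶1∶ z ]
    fromSum (inj₂ (inj₂ _)) = [0∶0∶1]

  decode : Fin (planeSize p) → Point
  decode = fromSum ∘ map₂ (splitAt p) ∘ splitAt (p ℕ.* p)

  encode : Point → Fin (planeSize p)
  encode [1∶ y ∶ z ] = combine {p} {p} y z ↑ˡ (p ℕ.+ 1)
  encode [0∶1∶ z ]   = (p ℕ.* p) ↑ʳ (z ↑ˡ 1)
  encode [0∶0∶1]     = (p ℕ.* p) ↑ʳ (p ↑ʳ zero)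

  decode-encode : ∀ x → decode (encode x) ≡ x
  decode-encode [1∶ y ∶ z ] = trans (cong (fromSum ∘ map₂ (splitAt p)) (splitAt-↑ˡ (p ℕ.* p) (combine y z) (p ℕ.+ 1)))
                                    (cong (uncurry [1∶_∶_]) (remQuot-combine {p} {p} y z))
  decode-encode [0∶1∶ z ]   = trans (cong (fromSum ∘ map₂ (splitAt p)) (splitAt-↑ʳ (p ℕ.* p) (p ℕ.+ 1) (z ↑ˡ 1)))
                                    (cong (fromSum ∘ inj₂) (splitAt-↑ˡ p z 1))
  decode-encode [0∶0∶1]     = trans (cong (fromSum ∘ map₂ (splitAt p)) (splitAt-↑ʳ (p ℕ.* p) (p ℕ.+ 1) (p ↑ʳ zero)))
                                    (cong (fromSum ∘ inj₂) (splitAt-↑ʳ p 1 zero))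

  encode-decode : ∀ i → encode (decode i) ≡ i
  encode-decode i with splitAt (p ℕ.* p) i in eq
  ... | inj₁ k = trans (cong (_↑ˡ (p ℕ.+ 1)) (combine-remQuot {p} p k)) (splitAt⁻¹-↑ˡ eq)
  ... | inj₂ j with splitAt p j in eq′
  ...   | inj₁ z    = trans (cong ((p ℕ.* p) ↑ʳ_) (splitAt⁻¹-↑ˡ eq′)) (splitAt⁻¹-↑ʳ eq)
  ...   | inj₂ zero = trans (cong ((p ℕ.* p) ↑ʳ_) (splitAt⁻¹-↑ʳ eq′)) (splitAt⁻¹-↑ʳ eq)

  decode-injective : ∀ {i j} → decode i ≡ decode j → i ≡ j
  decode-injective {i} {j} eq = trans (sym (encode-decode i)) (trans (cong encode eq) (encode-decode j))

  encode-injective : ∀ {x y} → encode x ≡ encode y → x ≡ y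
  encode-injective {x} {y} eq = trans (sym (decode-encode x)) (trans (cong decode eq) (decode-encode y))

  opaque
    _≟ₚ_ : DecidableEquality Point
    x ≟ₚ y = map′ encode-injective (cong encode) (encode x ≟ encode y)

  countPoints : (Point → Bool) → ℕ
  countPoints Q = count (Q ∘ decode)

  countPoints-split : ∀ Q → countPoints Q ≡
    sumFin (λ y → count (λ z → Q [1∶ y ∶ z ])) ℕ.+ (count (λ z → Q [0∶1∶ z ]) ℕ.+ indicator (Q [0∶0∶1]))
  countPoints-split Q =
    trans (count-↑ (p ℕ.* p) {p ℕ.+ 1} (Q ∘ decode)) (cong₂ ℕ._+_ affine (trans (count-↑ p {1} _) (cong₂ ℕ._+_ line pole)))
    where
    open ≡-Reasoning
    affine : count {p ℕ.* p} (λ k → Q (decode (k ↑ˡ (p ℕ.+ 1)))) ≡ sumFin (λ y → count (λ z → Q [1∶ y ∶ z ]))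
    affine = begin
      count {p ℕ.* p} (λ k → Q (decode (k ↑ˡ (p ℕ.+ 1))))
        ≡⟨ count-cong (λ k → cong (Q ∘ fromSum ∘ map₂ (splitAt p)) (splitAt-↑ˡ (p ℕ.* p) k (p ℕ.+ 1))) ⟩
      count {p ℕ.* p} (λ k → Q (uncurry [1∶_∶_] (remQuot p k)))
        ≡⟨ count-combine p {p} _ ⟩
      sumFin (λ y → count (λ z → Q (uncurry [1∶_∶_] (remQuot p (combine {p} {p} y z)))))
        ≡⟨ sumFin-cong (λ y → count-cong (λ z → cong (Q ∘ uncurry [1∶_∶_]) (remQuot-combine {p} {p} y z))) ⟩
      sumFin (λ y → count (λ z → Q [1∶ y ∶ z ]))  ∎
    atInfinity : ∀ j → Q (decode ((p ℕ.* p) ↑ʳ j)) ≡ Q (fromSum (inj₂ (splitAt p j)))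
    atInfinity j = cong (Q ∘ fromSum ∘ map₂ (splitAt p)) (splitAt-↑ʳ (p ℕ.* p) (p ℕ.+ 1) j)
    line : count (λ z → Q (decode ((p ℕ.* p) ↑ʳ (z ↑ˡ 1)))) ≡ count (λ z → Q [0∶1∶ z ])
    line = count-cong (λ z → trans (atInfinity (z ↑ˡ 1)) (cong (Q ∘ fromSum ∘ inj₂) (splitAt-↑ˡ p z 1)))
    pole : count {1} (λ i → Q (decode ((p ℕ.* p) ↑ʳ (p ↑ʳ i)))) ≡ indicator (Q [0∶0∶1])
    pole = trans (cong (λ b → indicator b ℕ.+ 0) (trans (atInfinity (p ↑ʳ zero)) (cong (Q ∘ fromSum ∘ inj₂) (splitAt-↑ʳ p 1 zero))))
                 (ℕ.+-identityʳ _)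

  private
    count-vanishing-const : ∀ (f : Fin p → ℤ) c → (∀ z → f z ≡ c) →
      count (λ z → vanishes (f z)) ≡ p ℕ.* indicator (vanishes c)
    count-vanishing-const f c f≡c = trans (count-cong (cong vanishes ∘ f≡c)) (count-const p (vanishes c))

    count-vanishing-linear : ∀ (f : Fin p → ℤ) e → (∀ z → f z ≡ + 1 * ι z + e) →
      count (λ z → vanishes (f z)) ≡ 1
    count-vanishing-linear f e f≡z+e = trans (count-cong (cong vanishes ∘ f≡z+e)) (linear-root-unique (+ 1) e P∤1)

    vanishes-0 : ∀ {x} → x ≡ + 0 → indicator (vanishes x) ≡ 1
    vanishes-0 refl = cong indicator (vanishes-complete P∣0)

    vanishes-1 : ∀ {x} → x ≡ + 1 → indicator (vanishes x) ≡ 0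
    vanishes-1 refl = cong indicator (vanishes-false P∤1)

  polar-size : ∀ x → countPoints (λ y → vanishes (form x y)) ≡ p ℕ.+ 1
  polar-size x = trans (countPoints-split (λ y → vanishes (form x y))) (by-type x)
    where
    by-type : ∀ x → sumFin (λ y → count (λ z → vanishes (form x [1∶ y ∶ z ])))
              ℕ.+ (count (λ z → vanishes (form x [0∶1∶ z ])) ℕ.+ indicator (vanishes (form x [0∶0∶1]))) ≡ p ℕ.+ 1
    by-type [1∶ a ∶ b ] = cong₂ ℕ._+_ affine (cong₂ ℕ._+_ line (vanishes-1 (ring₃ (ι a) (ι b))))
      where
      ring₁ : ∀ a b y z → + 1 * z + a * y + b * + 1 ≡ + 1 * z + (a * y + b)
      ring₁ = solve-∀
      ring₂ : ∀ a b z → + 1 * z + a * + 1 + b * + 0 ≡ + 1 * z + a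
      ring₂ = solve-∀
      ring₃ : ∀ a b → + 1 * + 1 + a * + 0 + b * + 0 ≡ + 1
      ring₃ = solve-∀
      affine : sumFin (λ y → count (λ z → vanishes (form [1∶ a ∶ b ] [1∶ y ∶ z ]))) ≡ p
      affine = trans (sumFin-cong (λ y → count-vanishing-linear _ _ (λ z → ring₁ (ι a) (ι b) (ι y) (ι z))))
                     (trans (sumFin-const p 1) (ℕ.*-identityʳ p))
      line : count (λ z → vanishes (form [1∶ a ∶ b ] [0∶1∶ z ])) ≡ 1
      line = count-vanishing-linear _ _ (λ z → ring₂ (ι a) (ι b) (ι z))
    by-type [0∶1∶ a ] = cong₂ ℕ._+_ affine (cong₂ ℕ._+_ line (vanishes-0 (ring₃ (ι a))))
      where
      ring₁ : ∀ a y z → + 0 * z + + 1 * y + a * + 1 ≡ + 1 * y + a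
      ring₁ = solve-∀
      ring₂ : ∀ a z → + 0 * z + + 1 * + 1 + a * + 0 ≡ + 1
      ring₂ = solve-∀
      ring₃ : ∀ a → + 0 * + 1 + + 1 * + 0 + a * + 0 ≡ + 0
      ring₃ = solve-∀
      affine : sumFin (λ y → count (λ z → vanishes (form [0∶1∶ a ] [1∶ y ∶ z ]))) ≡ p
      affine = begin
        sumFin (λ y → count (λ z → vanishes (form [0∶1∶ a ] [1∶ y ∶ z ])))
          ≡⟨ sumFin-cong (λ y → count-vanishing-const _ _ (λ z → ring₁ (ι a) (ι y) (ι z))) ⟩
        sumFin (λ y → p ℕ.* indicator (vanishes (+ 1 * ι y + ι a)))
          ≡⟨ sumFin-*ˡ p (λ y → indicator (vanishes (+ 1 * ι y + ι a))) ⟩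
        p ℕ.* sumFin (λ y → indicator (vanishes (+ 1 * ι y + ι a)))
          ≡⟨ cong (p ℕ.*_) (count≡sum-indicator (λ y → vanishes (+ 1 * ι y + ι a))) ⟨
        p ℕ.* count (λ y → vanishes (+ 1 * ι y + ι a))
          ≡⟨ cong (p ℕ.*_) (linear-root-unique (+ 1) (ι a) P∤1) ⟩
        p ℕ.* 1
          ≡⟨ ℕ.*-identityʳ p ⟩
        p ∎
        where open ≡-Reasoning
      line : count (λ z → vanishes (form [0∶1∶ a ] [0∶1∶ z ])) ≡ 0
      line = trans (count-vanishing-const _ _ (λ z → ring₂ (ι a) (ι z)))
                   (trans (cong (p ℕ.*_) (vanishes-1 refl)) (ℕ.*-zeroʳ p))
    by-type [0∶0∶1] = cong₂ ℕ._+_ affine (cong₂ ℕ._+_ line (vanishes-0 ring₃))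
      where
      ring₁ : ∀ y z → + 0 * z + + 0 * y + + 1 * + 1 ≡ + 1
      ring₁ = solve-∀
      ring₂ : ∀ z → + 0 * z + + 0 * + 1 + + 1 * + 0 ≡ + 0
      ring₂ = solve-∀
      ring₃ : + 0 * + 1 + + 0 * + 0 + + 1 * + 0 ≡ + 0
      ring₃ = solve-∀
      affine : sumFin (λ y → count (λ z → vanishes (form [0∶0∶1] [1∶ y ∶ z ]))) ≡ 0
      affine = trans (sumFin-cong (λ y → trans (count-vanishing-const _ _ (λ z → ring₁ (ι y) (ι z)))
                                               (trans (cong (p ℕ.*_) (vanishes-1 refl)) (ℕ.*-zeroʳ p))))
                     (trans (sumFin-const p 0) (ℕ.*-zeroʳ p))
      line : count (λ z → vanishes (form [0∶0∶1] [0∶1∶ z ])) ≡ p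
      line = trans (count-vanishing-const _ _ (λ z → ring₂ (ι z)))
                   (trans (cong (p ℕ.*_) (vanishes-0 refl)) (ℕ.*-identityʳ p))

  form-sym : ∀ x y → form x y ≡ form y x
  form-sym x y = ring (c₀ x) (c₁ x) (c₂ x) (c₀ y) (c₁ y) (c₂ y)
    where
    ring : ∀ a₀ a₁ a₂ b₀ b₁ b₂ → a₀ * b₂ + a₁ * b₁ + a₂ * b₀ ≡ b₀ * a₂ + b₁ * a₁ + b₂ * a₀
    ring = solve-∀

  absolute : Point → Bool
  absolute x = vanishes (form x x)

  -- [1∶ y ∶ z ] is absolute iff 2z + y² ≡ 0, so negating y permutes the absolute points;
  -- [1∶ 0 ∶ 0 ] and [0∶0∶1] are the remaining absolute pair.
  partner : Point → Point
  partner [1∶ y ∶ z ] with y ≟ 0ₚ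
  ... | yes _ = [0∶0∶1]
  ... | no  _ = [1∶ negate y ∶ z ]
  partner [0∶1∶ z ]   = [0∶1∶ z ]
  partner [0∶0∶1]     = [1∶ 0ₚ ∶ 0ₚ ]

  private
    P∣absolute : ∀ x → absolute x ≡ true → P ∣ form x x
    P∣absolute x = vanishes-sound

    P∣2z+y² : ∀ y z → absolute [1∶ y ∶ z ] ≡ true → P ∣ + 2 * ι z + ι y * ι y
    P∣2z+y² y z abs = subst (P ∣_) (ring (ι y) (ι z)) (P∣absolute [1∶ y ∶ z ] abs)
      where
      ring : ∀ y z → + 1 * z + y * y + z * + 1 ≡ + 2 * z + y * y
      ring = solve-∀

  partner-absolute : ∀ x → absolute x ≡ true → absolute (partner x) ≡ true
  partner-absolute [1∶ y ∶ z ] abs with y ≟ 0ₚ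
  ... | yes _ = vanishes-complete P∣0
  ... | no  _ = vanishes-complete (subst (P ∣_) (sym (ring (ι y) (ι (negate y)) (ι z)))
      (∣m∣n⇒∣m+n (P∣2z+y² y z abs) (∣m⇒∣m*n (ι (negate y) - ι y) (P∣negate[y]+y y))))
    where
    ring : ∀ y n z → + 1 * z + n * n + z * + 1 ≡ (+ 2 * z + y * y) + (n + y) * (n - y)
    ring = solve-∀
  partner-absolute [0∶1∶ z ] abs = abs
  partner-absolute [0∶0∶1]   abs =
    vanishes-complete (subst (P ∣_) (sym (cong (λ m → + 1 * m + m * m + m * + 1) ι0ₚ≡0)) P∣0)

  partner-involutive : ∀ x → absolute x ≡ true → partner (partner x) ≡ x
  partner-involutive [1∶ y ∶ z ] abs with y ≟ 0ₚ
  ... | yes refl = cong [1∶ 0ₚ ∶_] (sym (P∣ι⇒≡0ₚ z (P∣c*x⇒P∣x P∤2 (subst (P ∣_) (ring (ι z)) P∣z+0+z))))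
    where
    P∣z+0+z : P ∣ + 1 * ι z + + 0 * + 0 + ι z * + 1
    P∣z+0+z = subst (λ o → P ∣ + 1 * ι z + o * o + ι z * + 1) ι0ₚ≡0 (P∣absolute [1∶ 0ₚ ∶ z ] abs)
    ring : ∀ z → + 1 * z + + 0 * + 0 + z * + 1 ≡ + 2 * z
    ring = solve-∀
  ... | no  y≢0 with negate y ≟ 0ₚ
  ...   | yes -y≡0 = ⊥-elim (negate-≢0ₚ y≢0 -y≡0)
  ...   | no  _    = cong [1∶_∶ z ] (negate-involutive y)
  partner-involutive [0∶1∶ z ] abs = refl
  partner-involutive [0∶0∶1]   abs with 0ₚ ≟ 0ₚ
  ... | yes _   = refl
  ... | no  0≢0 = ⊥-elim (0≢0 refl)

  partner-off-polar : ∀ x → absolute x ≡ true → ¬ P ∣ form x (partner x)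
  partner-off-polar [1∶ y ∶ z ] abs with y ≟ 0ₚ
  ... | yes _   = λ P∣form → P∤1 (subst (P ∣_) (ring (ι y) (ι z)) P∣form)
    where
    ring : ∀ y z → + 1 * + 1 + y * + 0 + z * + 0 ≡ + 1
    ring = solve-∀
  ... | no  y≢0 = λ P∣form → y≢0 (P∣ι⇒≡0ₚ y (P∣x*x⇒P∣x (P∣c*x⇒P∣x P∤2 (P∣2y² P∣form))))
    where
    ring : ∀ y n z → (+ 2 * z + y * y) - (+ 1 * z + y * n + z * + 1) + y * (n + y) ≡ + 2 * (y * y)
    ring = solve-∀
    P∣2y² : P ∣ form [1∶ y ∶ z ] [1∶ negate y ∶ z ] → P ∣ + 2 * (ι y * ι y)
    P∣2y² P∣form = subst (P ∣_) (ring (ι y) (ι (negate y)) (ι z))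
      (∣m∣n⇒∣m+n (∣m∣n⇒∣m-n (P∣2z+y² y z abs) P∣form) (∣n⇒∣m*n (ι y) (P∣negate[y]+y y)))
  partner-off-polar [0∶1∶ z ] abs = ⊥-elim (P∤1 (subst (P ∣_) (ring (ι z)) (P∣absolute [0∶1∶ z ] abs)))
    where
    ring : ∀ z → + 0 * z + + 1 * + 1 + z * + 0 ≡ + 1
    ring = solve-∀
  partner-off-polar [0∶0∶1]   abs =
    λ P∣form → P∤1 (subst (P ∣_) (cong (λ m → + 0 * m + + 0 * m + + 1 * + 1) ι0ₚ≡0) P∣form)

  -- y is adjacent to x when it lies on the polar line of x. An absolute point lies on its own polar
  -- and so would have only p neighbours; the absolute points are paired up by partner instead.
  matched : Point → Point → Bool
  matched x y = absolute x ∧ does (y ≟ₚ partner x)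

  polarityAdj : Point → Point → Bool
  polarityAdj x y = (vanishes (form x y) ∧ not (does (y ≟ₚ x))) ∨ matched x y

  private
    matched⇒matched : ∀ x y → matched x y ≡ true → matched y x ≡ true
    matched⇒matched x y xy with does-sound (y ≟ₚ partner x) (∧-conicalʳ _ _ xy)
    ... | refl = cong₂ _∧_ (partner-absolute x abs) (dec-true (x ≟ₚ _) (sym (partner-involutive x abs)))
      where
      abs = ∧-conicalˡ _ _ xy

  matched-sym : ∀ x y → matched x y ≡ matched y x
  matched-sym x y = ⇔→≡ {z = true} (mk⇔ (matched⇒matched x y) (matched⇒matched y x))

  matched-off-polar : ∀ x y → matched x y ≡ true → vanishes (form x y) ≡ false
  matched-off-polar x y xy with does-sound (y ≟ₚ partner x) (∧-conicalʳ _ _ xy)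
  ... | refl = vanishes-false (partner-off-polar x (∧-conicalˡ _ _ xy))

  polarityAdj-sym : ∀ x y → polarityAdj x y ≡ polarityAdj y x
  polarityAdj-sym x y =
    cong₂ _∨_ (cong₂ _∧_ (cong vanishes (form-sym x y)) (cong not (does-⇔ (mk⇔ sym sym) (y ≟ₚ x) (x ≟ₚ y))))
              (matched-sym x y)

  matched-irrefl : ∀ x → matched x x ≡ false
  matched-irrefl x with matched x x in xx
  ... | false = refl
  ... | true with () ← trans (sym (∧-conicalˡ _ _ xx)) (matched-off-polar x x xx)

  polarityAdj-irrefl : ∀ x → polarityAdj x x ≡ false
  polarityAdj-irrefl x rewrite dec-true (x ≟ₚ x) refl | ∧-zeroʳ (vanishes (form x x)) = matched-irrefl x

  countPoints-≟ : ∀ b w → countPoints (λ y → b ∧ does (y ≟ₚ w)) ≡ indicator b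
  countPoints-≟ b w = begin
    count (λ i → b ∧ does (decode i ≟ₚ w))
      ≡⟨ count-∧-indicator b (λ i → does (decode i ≟ₚ w)) ⟩
    indicator b ℕ.* count (λ i → does (decode i ≟ₚ w))
      ≡⟨ cong (indicator b ℕ.*_) (count-unique _ (encode w) encoded only-encoded) ⟩
    indicator b ℕ.* 1
      ≡⟨ ℕ.*-identityʳ _ ⟩
    indicator b ∎
    where
    open ≡-Reasoning
    encoded : does (decode (encode w) ≟ₚ w) ≡ true
    encoded = dec-true (_ ≟ₚ w) (decode-encode w)
    only-encoded : ∀ i → does (decode i ≟ₚ w) ≡ true → i ≡ encode w
    only-encoded i i↦w = decode-injective (trans (does-sound (_ ≟ₚ w) i↦w) (sym (decode-encode w)))

  polarity-degree : ∀ x → countPoints (polarityAdj x) ≡ p ℕ.+ 1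
  polarity-degree x = begin
    countPoints (polarityAdj x)
      ≡⟨ count-∨-disjoint (λ i → off-diagonal (decode i)) (matched x ∘ decode) (disjoint ∘ decode) ⟩
    countPoints off-diagonal ℕ.+ countPoints (matched x)
      ≡⟨ cong (countPoints off-diagonal ℕ.+_) (countPoints-≟ (absolute x) (partner x)) ⟩
    countPoints off-diagonal ℕ.+ indicator (absolute x)
      ≡⟨ ℕ.+-comm (countPoints off-diagonal) _ ⟩
    indicator (absolute x) ℕ.+ countPoints off-diagonal
      ≡⟨ cong (ℕ._+ countPoints off-diagonal) (trans (count-cong diagonal) (countPoints-≟ (absolute x) x)) ⟨
    countPoints (λ y → vanishes (form x y) ∧ does (y ≟ₚ x)) ℕ.+ countPoints off-diagonal
      ≡⟨ count-split (λ i → vanishes (form x (decode i))) (λ i → does (decode i ≟ₚ x)) ⟨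
    countPoints (λ y → vanishes (form x y))
      ≡⟨ polar-size x ⟩
    p ℕ.+ 1 ∎
    where
    open ≡-Reasoning
    off-diagonal : Point → Bool
    off-diagonal y = vanishes (form x y) ∧ not (does (y ≟ₚ x))
    disjoint : ∀ y → off-diagonal y ∧ matched x y ≡ false
    disjoint y with matched x y in xy
    ... | false = ∧-zeroʳ _
    ... | true rewrite matched-off-polar x y xy = refl
    diagonal : ∀ i → (vanishes (form x (decode i)) ∧ does (decode i ≟ₚ x)) ≡ (absolute x ∧ does (decode i ≟ₚ x))
    diagonal i with decode i ≟ₚ x
    ... | yes refl = refl
    ... | no  _    = trans (∧-zeroʳ _) (sym (∧-zeroʳ _))

  -- A point orthogonal to x and y under form is represented by the cross product of the reversed
  -- coordinate vectors (c₂, c₁, c₀) of x and y.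
  private
    cross₀ cross₁ cross₂ : Point → Point → ℤ
    cross₀ x y = c₁ x * c₀ y - c₀ x * c₁ y
    cross₁ x y = c₀ x * c₂ y - c₂ x * c₀ y
    cross₂ x y = c₂ x * c₁ y - c₁ x * c₂ y

    P∤-1 : ¬ P ∣ - + 1
    P∤-1 = P∤1 ∘ ∣m⇒∣-m

    cross-nonzero : ∀ x y → x ≢ y → P ∣ cross₀ x y → P ∣ cross₁ x y → P ∣ cross₂ x y → ⊥
    cross-nonzero [1∶ a ∶ b ] [1∶ c ∶ d ] x≢y P∣₀ P∣₁ _
      with P∣ι-ι⇒≡ a c (subst (P ∣_) (ring₁ (ι a) (ι c)) P∣₀) | P∣ι-ι⇒≡ d b (subst (P ∣_) (ring₂ (ι b) (ι d)) P∣₁)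
      where
      ring₁ : ∀ a c → a * + 1 - + 1 * c ≡ a - c
      ring₁ = solve-∀
      ring₂ : ∀ b d → + 1 * d - b * + 1 ≡ d - b
      ring₂ = solve-∀
    ... | refl | refl = x≢y refl
    cross-nonzero [0∶1∶ a ] [0∶1∶ c ] x≢y _ _ P∣₂ with P∣ι-ι⇒≡ a c (subst (P ∣_) (ring (ι a) (ι c)) P∣₂)
      where
      ring : ∀ a c → a * + 1 - + 1 * c ≡ a - c
      ring = solve-∀
    ... | refl = x≢y refl
    cross-nonzero [0∶0∶1]     [0∶0∶1]     x≢y _ _ _ = x≢y refl
    cross-nonzero [1∶ a ∶ b ] [0∶1∶ c ]   _ P∣₀ _ _ = P∤-1 (subst (P ∣_) (ring (ι a)) P∣₀)
      where
      ring : ∀ a → a * + 0 - + 1 * + 1 ≡ - + 1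
      ring = solve-∀
    cross-nonzero [1∶ a ∶ b ] [0∶0∶1]     _ _ P∣₁ _ = P∤1 (subst (P ∣_) (ring (ι b)) P∣₁)
      where
      ring : ∀ b → + 1 * + 1 - b * + 0 ≡ + 1
      ring = solve-∀
    cross-nonzero [0∶1∶ a ]   [1∶ c ∶ d ] _ P∣₀ _ _ = P∤1 (subst (P ∣_) (ring (ι c)) P∣₀)
      where
      ring : ∀ c → + 1 * + 1 - + 0 * c ≡ + 1
      ring = solve-∀
    cross-nonzero [0∶1∶ a ]   [0∶0∶1]     _ _ _ P∣₂ = P∤-1 (subst (P ∣_) (ring (ι a)) P∣₂)
      where
      ring : ∀ a → a * + 0 - + 1 * + 1 ≡ - + 1
      ring = solve-∀
    cross-nonzero [0∶0∶1]     [1∶ c ∶ d ] _ _ P∣₁ _ = P∤-1 (subst (P ∣_) (ring (ι d)) P∣₁)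
      where
      ring : ∀ d → + 0 * d - + 1 * + 1 ≡ - + 1
      ring = solve-∀
    cross-nonzero [0∶0∶1]     [0∶1∶ c ]   _ _ _ P∣₂ = P∤1 (subst (P ∣_) (ring (ι c)) P∣₂)
      where
      ring : ∀ c → + 1 * + 1 - + 0 * c ≡ + 1
      ring = solve-∀

    Represents : Point → ℤ → ℤ → ℤ → Set
    Represents w a₀ a₁ a₂ = ∃[ μ ] P ∣ c₀ w - μ * a₀ × P ∣ c₁ w - μ * a₁ × P ∣ c₂ w - μ * a₂

    P∣1-μa : ∀ {a} μ → P ∣ a * μ - + 1 → P ∣ + 1 - μ * a
    P∣1-μa {a} μ P∣aμ-1 = subst (P ∣_) (ring a μ) (∣m⇒∣-m P∣aμ-1)
      where
      ring : ∀ a μ → - (a * μ - + 1) ≡ + 1 - μ * a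
      ring = solve-∀

    P∣0-μa : ∀ {a} μ → P ∣ a → P ∣ + 0 - μ * a
    P∣0-μa {a} μ P∣a = subst (P ∣_) (ring a μ) (∣m⇒∣-m (∣n⇒∣m*n μ P∣a))
      where
      ring : ∀ a μ → - (μ * a) ≡ + 0 - μ * a
      ring = solve-∀

    representative : ∀ a₀ a₁ a₂ → (P ∣ a₀ → P ∣ a₁ → P ∣ a₂ → ⊥) → ∃[ w ] Represents w a₀ a₁ a₂
    representative a₀ a₁ a₂ nonzero with P ∣? a₀ | P ∣? a₁ | P ∣? a₂
    ... | no P∤a₀ | _ | _ with inverse a₀ P∤a₀
    ...   | μ , P∣a₀μ-1 =
      [1∶ residue (μ * a₁) ∶ residue (μ * a₂) ] , μ , P∣1-μa μ P∣a₀μ-1 , P∣residue-x (μ * a₁) , P∣residue-x (μ * a₂)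
    representative a₀ a₁ a₂ nonzero | yes P∣a₀ | no P∤a₁ | _ with inverse a₁ P∤a₁
    ...   | μ , P∣a₁μ-1 =
      [0∶1∶ residue (μ * a₂) ] , μ , P∣0-μa μ P∣a₀ , P∣1-μa μ P∣a₁μ-1 , P∣residue-x (μ * a₂)
    representative a₀ a₁ a₂ nonzero | yes P∣a₀ | yes P∣a₁ | no P∤a₂ with inverse a₂ P∤a₂
    ...   | μ , P∣a₂μ-1 =
      [0∶0∶1] , μ , P∣0-μa μ P∣a₀ , P∣0-μa μ P∣a₁ , P∣1-μa μ P∣a₂μ-1
    representative a₀ a₁ a₂ nonzero | yes P∣a₀ | yes P∣a₁ | yes P∣a₂ = ⊥-elim (nonzero P∣a₀ P∣a₁ P∣a₂)

    represents⇒polar : ∀ w a₀ a₁ a₂ x → Represents w a₀ a₁ a₂ →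
      P ∣ a₀ * c₂ x + a₁ * c₁ x + a₂ * c₀ x → P ∣ form w x
    represents⇒polar w a₀ a₁ a₂ x (μ , P∣₀ , P∣₁ , P∣₂) P∣a·x =
      subst (P ∣_) (sym (ring (c₀ w) (c₁ w) (c₂ w) μ a₀ a₁ a₂ (c₂ x) (c₁ x) (c₀ x)))
        (∣m∣n⇒∣m+n (∣m∣n⇒∣m+n (∣m∣n⇒∣m+n (∣n⇒∣m*n μ P∣a·x) (∣n⇒∣m*n (c₂ x) P∣₀)) (∣n⇒∣m*n (c₁ x) P∣₁))
                   (∣n⇒∣m*n (c₀ x) P∣₂))
      where
      ring : ∀ w₀ w₁ w₂ μ a₀ a₁ a₂ s₀ s₁ s₂ → w₀ * s₀ + w₁ * s₁ + w₂ * s₂ ≡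
        μ * (a₀ * s₀ + a₁ * s₁ + a₂ * s₂) + s₀ * (w₀ - μ * a₀) + s₁ * (w₁ - μ * a₁) + s₂ * (w₂ - μ * a₂)
      ring = solve-∀

  common-polar : ∀ x y → x ≢ y → ∃[ w ] P ∣ form w x × P ∣ form w y
  common-polar x y x≢y with representative (cross₀ x y) (cross₁ x y) (cross₂ x y) (cross-nonzero x y x≢y)
  ... | w , w∝x×y = w , represents⇒polar w (cross₀ x y) (cross₁ x y) (cross₂ x y) x w∝x×y P∣[x×y]·x
                      , represents⇒polar w (cross₀ x y) (cross₁ x y) (cross₂ x y) y w∝x×y P∣[x×y]·y
    where
    ring₁ : ∀ a₀ a₁ a₂ b₀ b₁ b₂ →
      (a₁ * b₀ - a₀ * b₁) * a₂ + (a₀ * b₂ - a₂ * b₀) * a₁ + (a₂ * b₁ - a₁ * b₂) * a₀ ≡ + 0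
    ring₁ = solve-∀
    ring₂ : ∀ a₀ a₁ a₂ b₀ b₁ b₂ →
      (a₁ * b₀ - a₀ * b₁) * b₂ + (a₀ * b₂ - a₂ * b₀) * b₁ + (a₂ * b₁ - a₁ * b₂) * b₀ ≡ + 0
    ring₂ = solve-∀
    P∣[x×y]·x : P ∣ cross₀ x y * c₂ x + cross₁ x y * c₁ x + cross₂ x y * c₀ x
    P∣[x×y]·x = subst (P ∣_) (sym (ring₁ (c₀ x) (c₁ x) (c₂ x) (c₀ y) (c₁ y) (c₂ y))) P∣0
    P∣[x×y]·y : P ∣ cross₀ x y * c₂ y + cross₁ x y * c₁ y + cross₂ x y * c₀ y
    P∣[x×y]·y = subst (P ∣_) (sym (ring₂ (c₀ x) (c₁ x) (c₂ x) (c₀ y) (c₁ y) (c₂ y))) P∣0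

  polar⇒polarityAdj : ∀ x y → P ∣ form x y → y ≢ x → polarityAdj x y ≡ true
  polar⇒polarityAdj x y P∣xy y≢x rewrite vanishes-complete P∣xy | dec-false (y ≟ₚ x) y≢x = refl

  polarityGraph : Graph (planeSize p)
  polarityGraph = record
    { adj    = λ i j → polarityAdj (decode i) (decode j)
    ; sym    = λ i j → polarityAdj-sym (decode i) (decode j)
    ; irrefl = polarityAdj-irrefl ∘ decode
    }

  polarityGraph-degree : ∀ i → degree polarityGraph i ≡ p ℕ.+ 1
  polarityGraph-degree = polarity-degree ∘ decode

  polarityGraph-diameter : Diameter≤2 polarityGraph
  polarityGraph-diameter i j i≢j ¬ij = neighbour (common-polar (decode i) (decode j) (i≢j ∘ decode-injective))
    where
    adjacent : ∀ w k → P ∣ form w (decode k) → decode k ≢ w → polarityAdj (decode (encode w)) (decode k) ≡ true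
    adjacent w k P∣wk k≢w = subst (λ x → polarityAdj x (decode k) ≡ true) (sym (decode-encode w))
                                  (polar⇒polarityAdj w (decode k) P∣wk k≢w)
    not-i : ∀ w → P ∣ form w (decode j) → decode i ≢ w
    not-i w P∣wj refl with () ← trans (sym (polar⇒polarityAdj (decode i) (decode j) P∣wj (i≢j ∘ decode-injective ∘ sym))) ¬ij
    not-j : ∀ w → P ∣ form w (decode i) → decode j ≢ w
    not-j w P∣wi refl with () ← trans (sym (polar⇒polarityAdj (decode i) (decode j)
      (subst (P ∣_) (form-sym (decode j) (decode i)) P∣wi) (i≢j ∘ decode-injective ∘ sym))) ¬ij
    neighbour : (∃[ w ] P ∣ form w (decode i) × P ∣ form w (decode j)) →
                ∃[ k ] polarityAdj (decode k) (decode i) ≡ true × polarityAdj (decode k) (decode j) ≡ true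
    neighbour (w , P∣wi , P∣wj) = encode w , adjacent w i P∣wi (not-i w P∣wj) , adjacent w j P∣wj (not-j w P∣wi)

module Primes where

  open import Data.Nat using (suc; _+_; _*_; _≤_; _<_; s≤s; z≤n; _!; >-nonZero)
  open import Data.Nat.Properties using (<-irrefl; ≤-trans; 1≤n!; _<?_; ≮⇒≥; +-comm; *-comm)
  open import Data.Nat.Divisibility using (_∣_; divides; ∣-trans; m∣m*n; m≤n⇒m!∣n!; ∣m+n∣m⇒∣n; ∣1⇒≡1)
  open import Data.Nat.Primality using (Prime; ¬prime[1])
  open import Data.Nat.Primality.Factorisation using (factorise)
  open import Data.Nat.ListAction using (product)
  open import Data.List using ([]; _∷_)
  open import Data.List.Relation.Unary.All using (_∷_)
  open import Data.Product using (∃-syntax; _×_; _,_)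
  open import Data.Empty using (⊥-elim)
  open import Relation.Nullary using (yes; no)
  open import Relation.Binary.PropositionalEquality

  primeDivisor : ∀ m → 2 ≤ m → ∃[ q ] Prime q × q ∣ m
  primeDivisor m 2≤m with factorise m {{>-nonZero (≤-trans (s≤s z≤n) 2≤m)}}
  ... | record { factors = [] ; isFactorisation = m≡1 } = ⊥-elim (<-irrefl (sym m≡1) 2≤m)
  ... | record { factors = q ∷ qs ; isFactorisation = m≡q*qs ; factorsPrime = q-prime ∷ _ } =
    q , q-prime , divides (product qs) (trans m≡q*qs (*-comm q (product qs)))

  arbitrarilyLargePrime : ∀ K → ∃[ q ] Prime q × K < q
  arbitrarilyLargePrime K with primeDivisor (suc (K !)) (s≤s (1≤n! K))
  ... | q , q-prime , q∣K!+1 with K <? q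
  ...   | yes K<q = q , q-prime , K<q
  ...   | no  K≮q = ⊥-elim (¬prime[1] (subst Prime (∣1⇒≡1 q∣1) q-prime))
    where
    q∣q! : ∀ {q} → Prime q → q ∣ q !
    q∣q! {suc q′} _ = m∣m*n (q′ !)
    q∣1 : q ∣ 1
    q∣1 = ∣m+n∣m⇒∣n (subst (q ∣_) (+-comm 1 (K !)) q∣K!+1)
                    (∣-trans (q∣q! q-prime) (m≤n⇒m!∣n! (≮⇒≥ K≮q)))


open import Defs
open Graphs
open OversaturatedRegularGraphs
open Arithmetic
open BlowUp
open PolarityGraph
open Primes
open import Data.Nat using (ℕ; suc; _+_; _*_; _^_; _<_; _≤_; _≥_; NonZero; >-nonZero; z≤n)
open import Data.Nat.Properties
open import Data.Nat.Tactic.RingSolver using (solve-∀)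
open import Data.Product using (∃-syntax; _×_; _,_)
open import Relation.Binary.PropositionalEquality

orsat-lower-bound : ∀ t {n m} → IsOrsat t n m → ∀ a B .{{_ : NonZero B}} → 4 * a ^ 2 < t * B →
  4 * (t * B) * (t * B) * (4 * a ^ 2) + t * B < n → a ^ 2 * n ^ 3 < m ^ 2 * B
orsat-lower-bound t {n} ((G , (d , deg≡d) , oversaturated , edges≡m) , _) a B c<T N<n =
  subst (λ e → a ^ 2 * n ^ 3 < e ^ 2 * B) edges≡m
    (degree-lower⇒edges-lower {n} {edges G} {d} {{>-nonZero (≤-<-trans z≤n N<n)}} (regular-handshake G deg≡d) a B
      (t*n≤t*[1+d]+d²⇒c*n<d*d*B t B (4 * a ^ 2) n d c<T tn≤t[1+d]+d² N<n))
  where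
  tn≤t[1+d]+d² : t * n ≤ t * suc d + d * d
  tn≤t[1+d]+d² = regular-oversaturated⇒t*n≤t*[1+d]+d² G t oversaturated deg≡d

orsat-upper-bound : ∀ t {p m} (p-prime : Prime p) (2<p : 2 < p) → IsOrsat (suc t) (planeSize p * suc t) m →
  ∀ a B .{{_ : NonZero B}} → suc t * B < 4 * a ^ 2 → 3 * (suc t * B) ≤ p →
  m ^ 2 * B < a ^ 2 * (planeSize p * suc t) ^ 3
orsat-upper-bound t {p} {m} p-prime 2<p (_ , minimal) a B T<c 3T≤p =
  ≤-<-trans (*-monoˡ-≤ B (^-monoˡ-≤ 2 m≤e))
    (degree-upper⇒edges-upper {planeSize p * suc t} {edges G} {d} {{n≢0}} (regular-handshake G deg) a B
      (d<t*[p+2]⇒d*d*B<c*[planeSize*t] (suc t) B (4 * a ^ 2) p d 3T≤p T<c d<T[p+2]))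
  where
  n≢0 = m*n≢0 (planeSize p) (suc t) {{planeSize-nonZero p}}
  H = polarityGraph p-prime 2<p
  G = blowUp H (suc t)
  d = t + suc t * (p + 1)
  deg : ∀ i → degree G i ≡ d
  deg = blowUp-degree H t (polarityGraph-degree p-prime 2<p)
  m≤e : m ≤ edges G
  m≤e = minimal G (d , deg) (blowUp-oversaturated H (suc t) (polarityGraph-diameter p-prime 2<p))
  d<T[p+2] : d < suc t * (p + 2)
  d<T[p+2] = ≤-reflexive (ring t p)
    where
    ring : ∀ t p → suc (t + suc t * (p + 1)) ≡ suc t * (p + 2)
    ring = solve-∀

orsat-eventually-above : ∀ t (f : ℕ → ℕ) → (∀ n → IsOrsat t n (f n)) → ∀ a B .{{_ : NonZero B}} →
  4 * a ^ 2 < t * B → ∃[ N ] (∀ n → n ≥ N → a ^ 2 * n ^ 3 < f n ^ 2 * B)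
orsat-eventually-above t f orsat a B c<T =
  suc (4 * (t * B) * (t * B) * (4 * a ^ 2) + t * B) , λ n N<n → orsat-lower-bound t (orsat n) a B c<T N<n

orsat-infinitely-often-below : ∀ t (f : ℕ → ℕ) → (∀ n → IsOrsat (suc t) n (f n)) → ∀ a B .{{_ : NonZero B}} →
  suc t * B < 4 * a ^ 2 → ∀ N → ∃[ n ] (n ≥ N × f n ^ 2 * B < a ^ 2 * n ^ 3)
orsat-infinitely-often-below t f orsat a B T<c N with arbitrarilyLargePrime (N + 3 * (suc t * B) + 2)
... | p , p-prime , K<p = planeSize p * suc t , N≤n , orsat-upper-bound t p-prime 2<p (orsat _) a B T<c 3T≤p
  where
  2<p : 2 < p
  2<p = ≤-<-trans (m≤n+m 2 _) K<p
  3T≤p : 3 * (suc t * B) ≤ p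
  3T≤p = ≤-trans (m≤n+m _ N) (≤-trans (m≤m+n _ 2) (<⇒≤ K<p))
  N≤n : N ≤ planeSize p * suc t
  N≤n = ≤-trans (m≤m+n N _) (≤-trans (m≤m+n _ 2) (≤-trans (<⇒≤ K<p) (≤-trans (p≤planeSize p) (m≤m*n _ (suc t)))))

theorem1p5 : ∀ (t : ℕ) → 1 ≤ t → (f : ℕ → ℕ) → (∀ n → IsOrsat t n (f n)) →
  ((∀ (a b : ℕ) → 4 * a ^ 2 < t * suc b ^ 2 →
      ∃[ N ] (∀ n → n ≥ N → a ^ 2 * n ^ 3 < f n ^ 2 * suc b ^ 2))
  ×
  (∀ (a b : ℕ) → t * suc b ^ 2 < 4 * a ^ 2 →
      ∀ N → ∃[ n ] (n ≥ N × f n ^ 2 * suc b ^ 2 < a ^ 2 * n ^ 3)))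
theorem1p5 (suc t) _ f orsat =
  (λ a b → orsat-eventually-above (suc t) f orsat a (suc b ^ 2)) ,
  (λ a b → orsat-infinitely-often-below t f orsat a (suc b ^ 2))
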